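{- Let $U$ be a finite nonempty set of objects, $c\in\mathbb{N}$, and $w:U\to\mathbb{R}$ with $0<w(u)\le c$ for all $u\in U$. Let $S=\{u\in U\mid w(u)\le c/2\}$ and $L=\{u\in U\mid w(u)>c/2\}$. Consider the algorithm: $P_1:=\emptyset;\ P_2:=\emptyset;\ B_1:=\emptyset;\ B_2:=\emptyset;\ V:=U;$ while $V\cap S\neq\emptyset$ do: if $B_1\neq\emptyset$ then $u:=$ an arbitrary element of $V\cap S$; else if $V\cap L\neq\emptyset$ then $u:=$ an arbitrary element of $V\cap L$; else $u:=$ an arbitrary element of $V\cap S$; $V:=V\setminus\{u\}$; if $W(B_1)+w(u)\le c$ then $B_1:=B_1\cup\{u\}$ else [ (if $W(B_2)+w(u)\le c$ then $B_2:=B_2\cup\{u\}$ else ($P_2:=P_2\cup[\![B_2]\!]$; $B_2:=\{u\}$)); $P_1:=P_1\cup[\![B_1]\!]$; $B_1:=\emptyset$ ] od; $P:=P_1\cup[\![B_1]\!]\cup P_2\cup[\![B_2]\!]\cup\{\{v\}\mid v\in V\}$. Then upon termination $\mathrm{bp}(P)$ holds, and for every $Q$ with $\mathrm{bp}(Q)$ we have $|P|\le\frac32|Q|$.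
   Context: For $B\subseteq U$, $W(B)=\sum_{u\in B}w(u)$. $[\![B]\!]=\emptyset$ if $B=\emptyset$ and $[\![B]\!]=\{B\}$ otherwise. $\mathrm{bp}(P)$ holds iff $P$ is a partition of $U$ (i.e. $\bigcup P=U$, the elements of $P$ are pairwise disjoint, and $\emptyset\notin P$) and $W(B)\le c$ for every $B\in P$. -}

module Defs where

open import Level using (0ℓ)
open import Data.Nat as ℕ using (ℕ; zero; suc)
open import Data.Bool using (true; false; if_then_else_)
open import Data.Product using (Σ; ∃; ∃-syntax; _×_; _,_; proj₁; proj₂)
open import Data.Sum using (_⊎_; inj₁; inj₂)
open import Data.Empty using (⊥-elim)
open import Data.Fin using (Fin)
open import Data.Fin.Subset using (Subset; _∈_; _∩_; _∪_; _-_; ⁅_⁆; Nonempty; Empty)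
  renaming (⊥ to ∅)
open import Data.Fin.Subset.Properties using (_∈?_; nonempty?)
open import Data.Vec using (Vec; []; _∷_)
open import Data.List using (List; []; _∷_; _++_; map; filter; length)
open import Data.List.Base using (allFin)
open import Data.List.Relation.Unary.All using (All)
open import Data.List.Relation.Unary.Any using (Any)
open import Data.List.Relation.Unary.AllPairs using (AllPairs)
open import Relation.Nullary using (¬_; yes; no)
open import Relation.Binary using (Rel; Tri; tri<; tri≈; tri>)
open import Relation.Binary.Structures using (IsStrictTotalOrder)
open import Relation.Binary.PropositionalEquality using (_≡_; _≢_; refl; sym; trans; cong; subst)
open import Relation.Binary.Construct.Closure.ReflexiveTransitive using (Star)
open import Algebra.Structures using (IsCommutativeRing)

-- The real numbers, axiomatised as a (Dedekind-)complete ordered field.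
-- Any model of this record is isomorphic to ℝ; the theorem is stated
-- for an arbitrary such model.

record RealNumbers : Set₁ where
  infixl 6 _+_
  infixl 7 _*_
  infix 4 _<_ _≤_
  field
    Carrier : Set
    0# 1#   : Carrier
    _+_ _*_ : Carrier → Carrier → Carrier
    -_      : Carrier → Carrier
    _<_     : Rel Carrier 0ℓ
    isCommutativeRing : IsCommutativeRing _≡_ _+_ _*_ -_ 0# 1#
    0≢1     : 0# ≢ 1#
    inverse : ∀ x → x ≢ 0# → ∃[ y ] (x * y ≡ 1#)
    isStrictTotalOrder : IsStrictTotalOrder _≡_ _<_
    +-mono-< : ∀ {x y} z → x < y → x + z < y + z
    *-pos    : ∀ {x y} → 0# < x → 0# < y → 0# < x * y

  _≤_ : Rel Carrier 0ℓ
  x ≤ y = x < y ⊎ x ≡ y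

  field
    complete : (A : Carrier → Set) → ∃[ a ] A a → ∃[ b ] (∀ a → A a → a ≤ b) →
               ∃[ s ] ((∀ a → A a → a ≤ s) × (∀ b → (∀ a → A a → a ≤ b) → s ≤ b))

  open IsCommutativeRing isCommutativeRing public using (+-identityˡ)
  open IsStrictTotalOrder isStrictTotalOrder public using (compare; asym)

  fromℕ : ℕ → Carrier
  fromℕ zero    = 0#
  fromℕ (suc k) = 1# + fromℕ k

  two : Carrier
  two = 1# + 1#

  two≢0 : two ≢ 0#
  two≢0 eq with compare 0# 1#
  ... | tri< 0<1 _ _ = asym 0<1 (subst (λ z → z < 0#) (+-identityˡ 1#) (subst (λ z → 0# + 1# < z) eq (+-mono-< 1# 0<1)))
  ... | tri≈ _ 0≡1 _ = 0≢1 0≡1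
  ... | tri> _ _ 1<0 = asym 1<0 (subst (λ z → 0# < z) (+-identityˡ 1#) (subst (λ z → z < 0# + 1#) eq (+-mono-< 1# 1<0)))

  half : Carrier → Carrier
  half x = x * proj₁ (inverse two two≢0)

module BinPacking (ℝ : RealNumbers) {n : ℕ} (c : ℕ) (w : Fin n → RealNumbers.Carrier ℝ) where
  open RealNumbers ℝ

  cap : Carrier
  cap = fromℕ c

  Wgt : ∀ {m} → (Fin m → Carrier) → Subset m → Carrier
  Wgt {zero}  f []      = 0#
  Wgt {suc m} f (b ∷ B) = (if b then f Fin.zero else 0#) + Wgt (λ i → f (Fin.suc i)) B

  W : Subset n → Carrier
  W = Wgt w

  ⟦_⟧ : Subset n → List (Subset n)
  ⟦ B ⟧ with nonempty? B
  ... | yes _ = B ∷ []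
  ... | no  _ = []

  InS InL : Fin n → Set
  InS u = w u ≤ half cap
  InL u = half cap < w u

  -- families of blocks are represented as lists of subsets
  Disjoint : Subset n → Subset n → Set
  Disjoint A B = Empty (A ∩ B)

  bp : List (Subset n) → Set
  bp P = (∀ u → Any (u ∈_) P)
       × AllPairs Disjoint P
       × All Nonempty P
       × All (λ B → W B ≤ cap) P

  record State : Set where
    constructor ⟨_,_,_,_,_⟩
    field
      P₁ P₂ : List (Subset n)
      B₁ B₂ V : Subset n
  open State public

  initial : State
  initial = ⟨ [] , [] , ∅ , ∅ , Data.Fin.Subset.⊤ ⟩

  Guard : Subset n → Set
  Guard V = ∃[ v ] (v ∈ V × InS v)

  Choice : State → Fin n → Set
  Choice s u = u ∈ V s ×
    ( (Nonempty (B₁ s) × InS u)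
    ⊎ (Empty (B₁ s) × (∃[ v ] (v ∈ V s × InL v)) × InL u)
    ⊎ (Empty (B₁ s) × ¬ (∃[ v ] (v ∈ V s × InL v)) × InS u))

  data Step : State → State → Set where
    fit₁  : ∀ {P₁ P₂ B₁ B₂ V} u → Guard V → Choice ⟨ P₁ , P₂ , B₁ , B₂ , V ⟩ u →
            W B₁ + w u ≤ cap →
            Step ⟨ P₁ , P₂ , B₁ , B₂ , V ⟩ ⟨ P₁ , P₂ , B₁ ∪ ⁅ u ⁆ , B₂ , V - u ⟩
    fit₂  : ∀ {P₁ P₂ B₁ B₂ V} u → Guard V → Choice ⟨ P₁ , P₂ , B₁ , B₂ , V ⟩ u →
            ¬ (W B₁ + w u ≤ cap) → W B₂ + w u ≤ cap →
            Step ⟨ P₁ , P₂ , B₁ , B₂ , V ⟩ ⟨ P₁ ++ ⟦ B₁ ⟧ , P₂ , ∅ , B₂ ∪ ⁅ u ⁆ , V - u ⟩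
    new₂  : ∀ {P₁ P₂ B₁ B₂ V} u → Guard V → Choice ⟨ P₁ , P₂ , B₁ , B₂ , V ⟩ u →
            ¬ (W B₁ + w u ≤ cap) → ¬ (W B₂ + w u ≤ cap) →
            Step ⟨ P₁ , P₂ , B₁ , B₂ , V ⟩ ⟨ P₁ ++ ⟦ B₁ ⟧ , P₂ ++ ⟦ B₂ ⟧ , ∅ , ⁅ u ⁆ , V - u ⟩

  Reachable : State → Set
  Reachable s = Star Step initial s

  Terminated : State → Set
  Terminated s = ¬ Guard (V s)

  singletons : Subset n → List (Subset n)
  singletons V = map ⁅_⁆ (filter (_∈? V) (allFin n))

  output : State → List (Subset n)
  output s = P₁ s ++ ⟦ B₁ s ⟧ ++ P₂ s ++ ⟦ B₂ s ⟧ ++ singletons (V s)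

-- The algorithm keeps U partitioned into P₁, B₁, P₂, B₂ and the unprocessed items V, and every
-- block it creates fits, so the output is a packing. Against any packing Q:
--
-- (1) A first bin B₁ is closed only when the chosen item u does not fit, and u then goes to the
--     second bin; so W(B₁) + w(u) > c for every closed first bin, these pairs are disjoint, and
--     |P₁|·c < W(U) ≤ |Q|·c unless P₁ = ∅. Either way |P₁| < |Q|.
-- (2) A second bin is closed only after it received items at two closings of first bins: a lone
--     small item would have left room for the next small item. So 2(|P₂| + |⟦B₂⟧|) ≤ |P₁| + |⟦B₂⟧|.
-- (3) While large items (weight > c/2) remain, every empty first bin is opened with one, and at
--     termination V holds only large items. So if V ≠ ∅, the blocks of P₁, ⟦B₁⟧ and the leftover
--     singletons carry distinct large items; no bin of Q holds two, so |P₁| + |⟦B₁⟧| + |V| ≤ |Q|.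
--
-- Adding these up gives 2|P| ≤ 3|Q|.

module Submission where

open import Level using (0ℓ)
open import Algebra.Core using (Op₂)
open import Algebra.Bundles using (CommutativeMonoid)
open import Algebra.Structures using (IsCommutativeMonoid; IsCommutativeRing)
import Algebra.Definitions.RawMonoid as RawMonoid
import Algebra.Properties.CommutativeSemigroup as CommutativeSemigroupProperties
import Algebra.Properties.Monoid.Mult as MonoidMult
open import Data.Bool using (true; false; if_then_else_)
open import Data.Empty using (⊥-elim)
open import Data.Fin using (Fin; zero; suc; _≟_; fromℕ<)
open import Data.Fin.Properties using (suc-injective; 0≢1+n)
open import Data.Fin.Subset using (Subset; Nonempty; Empty; inside; outside; _∈_; _∉_; _∪_; _∩_; _-_; ⁅_⁆; ⊤; ⊥)
open import Data.Fin.Subset.Properties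
  using (_∈?_; nonempty?; Empty-unique; ∪-identityˡ; ∉⊥; ∈⊤; drop-there; x∈⁅x⁆; x≢y⇒x∉⁅y⁆; x∈⁅y⁆⇒x≡y;
         x∈p∪q⁺; x∈p∪q⁻; x∈p∩q⁻; p─q⊆p; x∈p∧x≢y⇒x∈p-y)
open import Data.List using (List; []; _∷_; _++_; map; filter; tabulate; allFin; length)
open import Data.List.Properties using (map-++; map-tabulate; length-++)
open import Data.List.Relation.Unary.All as All using (All; []; _∷_; universal)
open import Data.List.Relation.Unary.All.Properties using (++⁺; map⁺; all-filter)
open import Data.List.Relation.Unary.AllPairs using (AllPairs; []; _∷_)
open import Data.List.Relation.Unary.Any using (Any; here; there)
open import Data.Nat as ℕ using (ℕ; zero; suc; z≤n; s≤s)
import Data.Nat.Properties as ℕ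
open import Data.Nat.ListAction using (sum)
open import Data.Nat.ListAction.Properties using (sum-++)
open import Data.Nat.Tactic.RingSolver using (solve-∀)
open import Data.Product using (_,_; proj₁; proj₂; ∃; _×_)
open import Data.Sum using (_⊎_; inj₁; inj₂; [_,_]′)
open import Data.Vec using ([]; _∷_; tail)
open import Data.Vec.Base using () renaming (here to ∈-zero; there to ∈-suc)
open import Function using (id; _∘_)
open import Relation.Binary using (Rel; IsPartialOrder; IsStrictTotalOrder; StrictPartialOrder; _Preserves₂_⟶_⟶_; tri<; tri≈; tri>)
import Relation.Binary.Construct.StrictToNonStrict as StrictToNonStrict
import Relation.Binary.Reasoning.StrictPartialOrder as StrictPartialOrderReasoning
open import Relation.Binary.PropositionalEquality
  using (_≡_; _≢_; refl; sym; trans; cong; cong₂; subst; subst₂; module ≡-Reasoning)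
open import Relation.Nullary using (Dec; does; yes; no; ¬_)
open import Relation.Nullary.Decidable using (dec-true; dec-false)

open import Defs using (RealNumbers; module BinPacking)

module _ where
  open import Data.Nat using (_+_; _*_; _≤_)

  𝟙 : ∀ {A : Set} → Dec A → ℕ
  𝟙 a? = if does a? then 1 else 0

  indicator : ∀ {m} → Subset m → Fin m → ℕ
  indicator B x = 𝟙 (x ∈? B)

  multiplicity : ∀ {m} → Fin m → List (Subset m) → ℕ
  multiplicity x L = sum (map (λ B → indicator B x) L)

  𝟙-yes : ∀ {A : Set} (a? : Dec A) → A → 𝟙 a? ≡ 1
  𝟙-yes a? a rewrite dec-true a? a = refl

  𝟙-no : ∀ {A : Set} (a? : Dec A) → ¬ A → 𝟙 a? ≡ 0
  𝟙-no a? ¬a rewrite dec-false a? ¬a = refl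

  𝟙-cong : ∀ {A B : Set} (a? : Dec A) (b? : Dec B) → (A → B) → (B → A) → 𝟙 a? ≡ 𝟙 b?
  𝟙-cong (yes _) (yes _) _   _   = refl
  𝟙-cong (no _)  (no _)  _   _   = refl
  𝟙-cong (yes a) (no ¬b) A→B _   = ⊥-elim (¬b (A→B a))
  𝟙-cong (no ¬a) (yes b) _   B→A = ⊥-elim (¬a (B→A b))

  x∉p-x : ∀ {m} (p : Subset m) x → x ∉ p - x
  x∉p-x (_ ∷ p) zero    ()
  x∉p-x (_ ∷ p) (suc x) = x∉p-x p x ∘ drop-there

  indicator-⁅⁆-≢ : ∀ {m} {u x : Fin m} → u ≢ x → indicator ⁅ u ⁆ x ≡ 0
  indicator-⁅⁆-≢ {u = u} {x} u≢x = 𝟙-no (x ∈? ⁅ u ⁆) (λ x∈⁅u⁆ → u≢x (sym (x∈⁅y⁆⇒x≡y u x∈⁅u⁆)))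

  indicator-∪-⁅⁆ : ∀ {m} {B : Subset m} {u} → u ∉ B → ∀ x → indicator (B ∪ ⁅ u ⁆) x ≡ indicator B x + indicator ⁅ u ⁆ x
  indicator-∪-⁅⁆ {B = B} {u} u∉B x with u ≟ x
  ... | yes refl = trans (𝟙-yes (u ∈? B ∪ ⁅ u ⁆) (x∈p∪q⁺ (inj₂ (x∈⁅x⁆ u))))
                         (sym (cong₂ _+_ (𝟙-no (u ∈? B) u∉B) (𝟙-yes (u ∈? ⁅ u ⁆) (x∈⁅x⁆ u))))
  ... | no u≢x = begin
      indicator (B ∪ ⁅ u ⁆) x         ≡⟨ 𝟙-cong (x ∈? B ∪ ⁅ u ⁆) (x ∈? B) drop-u (x∈p∪q⁺ ∘ inj₁) ⟩
      indicator B x                   ≡⟨ sym (ℕ.+-identityʳ _) ⟩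
      indicator B x + 0             ≡⟨ cong (indicator B x +_) (sym (indicator-⁅⁆-≢ u≢x)) ⟩
      indicator B x + indicator ⁅ u ⁆ x ∎
    where
      open ≡-Reasoning
      drop-u : x ∈ B ∪ ⁅ u ⁆ → x ∈ B
      drop-u x∈ = [ id , (λ x∈⁅u⁆ → ⊥-elim (u≢x (sym (x∈⁅y⁆⇒x≡y u x∈⁅u⁆)))) ]′ (x∈p∪q⁻ B ⁅ u ⁆ x∈)

  indicator-─-⁅⁆ : ∀ {m} {V : Subset m} {u} → u ∈ V → ∀ x → indicator (V - u) x + indicator ⁅ u ⁆ x ≡ indicator V x
  indicator-─-⁅⁆ {V = V} {u} u∈V x with u ≟ x
  ... | yes refl = trans (cong₂ _+_ (𝟙-no (u ∈? V - u) (x∉p-x V u)) (𝟙-yes (u ∈? ⁅ u ⁆) (x∈⁅x⁆ u)))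
                         (sym (𝟙-yes (u ∈? V) u∈V))
  ... | no u≢x = begin
      indicator (V - u) x + indicator ⁅ u ⁆ x ≡⟨ cong (indicator (V - u) x +_) (indicator-⁅⁆-≢ u≢x) ⟩
      indicator (V - u) x + 0               ≡⟨ ℕ.+-identityʳ _ ⟩
      indicator (V - u) x                     ≡⟨ 𝟙-cong (x ∈? V - u) (x ∈? V) (p─q⊆p V ⁅ u ⁆) keep-x ⟩
      indicator V x                           ∎
    where
      open ≡-Reasoning
      keep-x : x ∈ V → x ∈ V - u
      keep-x x∈V = x∈p∧x≢y⇒x∈p-y x∈V (u≢x ∘ sym)

  indicator-⊥ : ∀ {m} (x : Fin m) → indicator ⊥ x ≡ 0
  indicator-⊥ x = 𝟙-no (x ∈? ⊥) ∉⊥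

  indicator-⊤ : ∀ {m} (x : Fin m) → indicator ⊤ x ≡ 1
  indicator-⊤ x = 𝟙-yes (x ∈? ⊤) ∈⊤

  multiplicity-[⊤] : ∀ {m} (x : Fin m) → multiplicity x (⊤ ∷ []) ≡ 1
  multiplicity-[⊤] x = trans (ℕ.+-identityʳ _) (indicator-⊤ x)

  multiplicity-≥1⇒Any : ∀ {m} {x : Fin m} L → 1 ≤ multiplicity x L → Any (x ∈_) L
  multiplicity-≥1⇒Any {x = x} (B ∷ L) 1≤ with x ∈? B
  ... | yes x∈B = here x∈B
  ... | no _    = there (multiplicity-≥1⇒Any L 1≤)

  Any⇒multiplicity≥1 : ∀ {m} {x : Fin m} {L} → Any (x ∈_) L → 1 ≤ multiplicity x L
  Any⇒multiplicity≥1 {x = x} {B ∷ L} (here x∈B) rewrite 𝟙-yes (x ∈? B) x∈B = s≤s z≤n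
  Any⇒multiplicity≥1 {x = x} {B ∷ L} (there x∈L) = ℕ.≤-trans (Any⇒multiplicity≥1 x∈L) (ℕ.m≤n+m _ (indicator B x))

  Any⇒multiplicity-[⊤]≤ : ∀ {m} {x : Fin m} {L} → Any (x ∈_) L → multiplicity x (⊤ ∷ []) ≤ multiplicity x L
  Any⇒multiplicity-[⊤]≤ {x = x} {L} x∈L = subst (_≤ multiplicity x L) (sym (multiplicity-[⊤] x)) (Any⇒multiplicity≥1 x∈L)

  multiplicity≤1⇒disjoint : ∀ {m} (L : List (Subset m)) → (∀ x → multiplicity x L ≤ 1) →
    AllPairs (λ A B → Empty (A ∩ B)) L
  multiplicity≤1⇒disjoint []      _    = []
  multiplicity≤1⇒disjoint (A ∷ L) mult≤1 =
    disjoint-from-rest L (λ x → mult≤1 x) ∷ multiplicity≤1⇒disjoint L (λ x → ℕ.≤-trans (ℕ.m≤n+m _ (indicator A x)) (mult≤1 x))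
    where
      disjoint-from-rest : ∀ L → (∀ x → indicator A x + multiplicity x L ≤ 1) → All (λ B → Empty (A ∩ B)) L
      disjoint-from-rest []      _  = []
      disjoint-from-rest (B ∷ L) ≤1 =
        A∩B-empty ∷ disjoint-from-rest L (λ x → ℕ.≤-trans (ℕ.+-monoʳ-≤ (indicator A x) (ℕ.m≤n+m _ (indicator B x))) (≤1 x))
        where
          A∩B-empty : Empty (A ∩ B)
          A∩B-empty (x , x∈A∩B) with x∈p∩q⁻ A B x∈A∩B
          ... | x∈A , x∈B with ≤1 x
          ... | twice≤1 rewrite 𝟙-yes (x ∈? A) x∈A | 𝟙-yes (x ∈? B) x∈B with twice≤1
          ... | s≤s ()

  multiplicity-++ : ∀ {m} (x : Fin m) L L′ → multiplicity x (L ++ L′) ≡ multiplicity x L + multiplicity x L′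
  multiplicity-++ x L L′ = trans (cong sum (map-++ _ L L′)) (sum-++ (map _ L) _)

  multiplicity-suc : ∀ {m} (x : Fin m) L → multiplicity (suc x) L ≡ multiplicity x (map tail L)
  multiplicity-suc x [] = refl
  multiplicity-suc x ((_ ∷ B) ∷ L) = cong (indicator B x +_) (multiplicity-suc x L)

  indicator-⁅⁆-*ˡ : ∀ {m} (V : Subset m) y x → indicator V x * indicator ⁅ y ⁆ x ≡ indicator V y * indicator ⁅ y ⁆ x
  indicator-⁅⁆-*ˡ V y x with y ≟ x
  ... | yes refl = refl
  ... | no y≢x   = trans (cong (indicator V x *_) y∉) (trans (ℕ.*-zeroʳ (indicator V x))
                     (sym (trans (cong (indicator V y *_) y∉) (ℕ.*-zeroʳ (indicator V y)))))
    where
      y∉ : indicator ⁅ y ⁆ x ≡ 0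
      y∉ = indicator-⁅⁆-≢ y≢x

  multiplicity-⁅⁆-filter : ∀ {m} (V : Subset m) x ys →
    multiplicity x (map ⁅_⁆ (filter (_∈? V) ys)) ≡ indicator V x * multiplicity x (map ⁅_⁆ ys)
  multiplicity-⁅⁆-filter V x [] = sym (ℕ.*-zeroʳ (indicator V x))
  multiplicity-⁅⁆-filter V x (y ∷ ys) with y ∈? V in y∈?V
  ... | yes y∈V = begin
      indicator ⁅ y ⁆ x + multiplicity x (map ⁅_⁆ (filter (_∈? V) ys))
        ≡⟨ cong₂ _+_ kept (multiplicity-⁅⁆-filter V x ys) ⟩
      indicator V x * indicator ⁅ y ⁆ x + indicator V x * multiplicity x (map ⁅_⁆ ys)
        ≡⟨ sym (ℕ.*-distribˡ-+ (indicator V x) _ _) ⟩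
      indicator V x * (indicator ⁅ y ⁆ x + multiplicity x (map ⁅_⁆ ys)) ∎
    where
      open ≡-Reasoning
      kept : indicator ⁅ y ⁆ x ≡ indicator V x * indicator ⁅ y ⁆ x
      kept = sym (trans (indicator-⁅⁆-*ˡ V y x) (trans (cong (λ d → 𝟙 d * _) y∈?V) (ℕ.+-identityʳ _)))
  ... | no y∉V = begin
      multiplicity x (map ⁅_⁆ (filter (_∈? V) ys))
        ≡⟨ multiplicity-⁅⁆-filter V x ys ⟩
      indicator V x * multiplicity x (map ⁅_⁆ ys)
        ≡⟨ cong (_+ (indicator V x * multiplicity x (map ⁅_⁆ ys))) dropped ⟩
      indicator V x * indicator ⁅ y ⁆ x + indicator V x * multiplicity x (map ⁅_⁆ ys)
        ≡⟨ sym (ℕ.*-distribˡ-+ (indicator V x) _ _) ⟩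
      indicator V x * (indicator ⁅ y ⁆ x + multiplicity x (map ⁅_⁆ ys)) ∎
    where
      open ≡-Reasoning
      dropped : 0 ≡ indicator V x * indicator ⁅ y ⁆ x
      dropped = sym (trans (indicator-⁅⁆-*ˡ V y x) (cong (λ d → 𝟙 d * _) y∈?V))

  multiplicity-tabulate-∉ : ∀ {m k} (x : Fin m) (f : Fin k → Subset m) → (∀ i → x ∉ f i) → multiplicity x (tabulate f) ≡ 0
  multiplicity-tabulate-∉ {k = zero}  x f x∉ = refl
  multiplicity-tabulate-∉ {k = suc k} x f x∉ = cong₂ _+_ (𝟙-no (x ∈? f zero) (x∉ zero)) (multiplicity-tabulate-∉ x (f ∘ suc) (x∉ ∘ suc))

  multiplicity-tabulate-⁅⁆ : ∀ {m} (x : Fin m) → multiplicity x (tabulate ⁅_⁆) ≡ 1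
  multiplicity-tabulate-⁅⁆ {suc m} zero    =
    cong suc (multiplicity-tabulate-∉ {k = m} zero (⁅_⁆ ∘ suc) (λ i → x≢y⇒x∉⁅y⁆ {x = zero} {y = suc i} λ ()))
  multiplicity-tabulate-⁅⁆ {suc m} (suc x) = cong₂ _+_ (indicator-⁅⁆-≢ {u = zero} {x = suc x} λ ())
    (trans (multiplicity-suc x (tabulate (⁅_⁆ ∘ suc))) (trans (cong (multiplicity x) (map-tabulate (⁅_⁆ ∘ suc) tail)) (multiplicity-tabulate-⁅⁆ x)))

  multiplicity-singletons : ∀ {m} (V : Subset m) x → multiplicity x (map ⁅_⁆ (filter (_∈? V) (allFin m))) ≡ indicator V x
  multiplicity-singletons {m} V x = begin
    multiplicity x (map ⁅_⁆ (filter (_∈? V) (allFin m))) ≡⟨ multiplicity-⁅⁆-filter V x (allFin m) ⟩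
    indicator V x * multiplicity x (map ⁅_⁆ (allFin m)) ≡⟨ cong (λ L → indicator V x * multiplicity x L) (map-tabulate id ⁅_⁆) ⟩
    indicator V x * multiplicity x (tabulate ⁅_⁆)      ≡⟨ cong (indicator V x *_) (multiplicity-tabulate-⁅⁆ x) ⟩
    indicator V x * 1                                 ≡⟨ ℕ.*-identityʳ _ ⟩
    indicator V x ∎
    where open ≡-Reasoning
  indicator-⁅⁆≤ : ∀ {m} {B : Subset m} {x} → x ∈ B → ∀ y → indicator ⁅ x ⁆ y ≤ indicator B y
  indicator-⁅⁆≤ {B = B} {x} x∈B y with x ≟ y
  ... | yes refl = ℕ.≤-reflexive (trans (𝟙-yes (x ∈? ⁅ x ⁆) (x∈⁅x⁆ x)) (sym (𝟙-yes (x ∈? B) x∈B)))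
  ... | no x≢y   = ℕ.≤-trans (ℕ.≤-reflexive (indicator-⁅⁆-≢ x≢y)) z≤n

  indicator-⁅⁆+⁅⁆≤ : ∀ {m} {B : Subset m} {x y} → x ≢ y → x ∈ B → y ∈ B →
    ∀ z → indicator ⁅ x ⁆ z + indicator ⁅ y ⁆ z ≤ indicator B z
  indicator-⁅⁆+⁅⁆≤ {B = B} {x} {y} x≢y x∈B y∈B z with x ≟ z | y ≟ z
  ... | yes refl | yes refl = ⊥-elim (x≢y refl)
  ... | yes refl | no y≢x   =
    ℕ.≤-reflexive (trans (cong₂ _+_ (𝟙-yes (x ∈? ⁅ x ⁆) (x∈⁅x⁆ x)) (indicator-⁅⁆-≢ y≢x)) (sym (𝟙-yes (x ∈? B) x∈B)))
  ... | no x≢y   | yes refl =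
    ℕ.≤-reflexive (trans (cong₂ _+_ (indicator-⁅⁆-≢ x≢y) (𝟙-yes (y ∈? ⁅ y ⁆) (x∈⁅x⁆ y))) (sym (𝟙-yes (y ∈? B) y∈B)))
  ... | no x≢z   | no y≢z   = ℕ.≤-trans (ℕ.≤-reflexive (cong₂ _+_ (indicator-⁅⁆-≢ x≢z) (indicator-⁅⁆-≢ y≢z))) z≤n

record OrderedCommutativeMonoid : Set₁ where
  infix  4 _≤_
  infixl 6 _∙_
  field
    Carrier : Set
    _≤_ : Rel Carrier 0ℓ
    _∙_ : Op₂ Carrier
    ε   : Carrier
    isCommutativeMonoid : IsCommutativeMonoid _≡_ _∙_ ε
    ≤-isPartialOrder : IsPartialOrder _≡_ _≤_
    ∙-mono-≤ : _∙_ Preserves₂ _≤_ ⟶ _≤_ ⟶ _≤_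

  commutativeMonoid : CommutativeMonoid 0ℓ 0ℓ
  commutativeMonoid = record { isCommutativeMonoid = isCommutativeMonoid }

  open IsCommutativeMonoid isCommutativeMonoid public using (identityˡ; identityʳ; assoc)
  open IsPartialOrder ≤-isPartialOrder public using (antisym) renaming (refl to ≤-refl; trans to ≤-trans)

module SubsetSums (M : OrderedCommutativeMonoid) where
  open OrderedCommutativeMonoid M
  open RawMonoid (CommutativeMonoid.rawMonoid commutativeMonoid) public using () renaming (_×_ to _·_)
  open MonoidMult (CommutativeMonoid.monoid commutativeMonoid) using () renaming (×-homo-+ to ·-homo-+)
  open CommutativeSemigroupProperties (CommutativeMonoid.commutativeSemigroup commutativeMonoid) using (interchange)

  subsetSum : ∀ {m} → (Fin m → Carrier) → Subset m → Carrier
  subsetSum {zero}  f []      = ε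
  subsetSum {suc m} f (b ∷ B) = (if b then f zero else ε) ∙ subsetSum (λ i → f (suc i)) B

  blockSum : ∀ {m} → (Fin m → Carrier) → List (Subset m) → Carrier
  blockSum f []      = ε
  blockSum f (B ∷ L) = subsetSum f B ∙ blockSum f L

  blockSum-[_] : ∀ {m} {f : Fin m → Carrier} B → blockSum f (B ∷ []) ≡ subsetSum f B
  blockSum-[ B ] = identityʳ _

  subsetSum-⊥ : ∀ {m} (f : Fin m → Carrier) → subsetSum f ⊥ ≡ ε
  subsetSum-⊥ {zero}  f = refl
  subsetSum-⊥ {suc m} f = trans (identityˡ _) (subsetSum-⊥ (λ i → f (suc i)))

  subsetSum-⁅⁆ : ∀ {m} (f : Fin m → Carrier) x → subsetSum f ⁅ x ⁆ ≡ f x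
  subsetSum-⁅⁆ f zero    = trans (cong (f zero ∙_) (subsetSum-⊥ (λ i → f (suc i)))) (identityʳ _)
  subsetSum-⁅⁆ f (suc x) = trans (identityˡ _) (subsetSum-⁅⁆ (λ i → f (suc i)) x)

  blockSum-empty : ∀ (f : Fin 0 → Carrier) L → blockSum f L ≡ ε
  blockSum-empty f []       = refl
  blockSum-empty f ([] ∷ L) = trans (identityˡ _) (blockSum-empty f L)

  ·-monoˡ-≤ : ∀ {j k} x → ε ≤ x → j ℕ.≤ k → j · x ≤ k · x
  ·-monoˡ-≤ {zero}  {zero}  x ε≤x z≤n     = ≤-refl
  ·-monoˡ-≤ {zero}  {suc k} x ε≤x z≤n     = subst (_≤ suc k · x) (identityˡ ε) (∙-mono-≤ ε≤x (·-monoˡ-≤ {k = k} x ε≤x z≤n))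
  ·-monoˡ-≤ {suc j} {suc k} x ε≤x (s≤s p) = ∙-mono-≤ ≤-refl (·-monoˡ-≤ x ε≤x p)

  blockSum-decompose : ∀ {m} (f : Fin (suc m) → Carrier) L →
    blockSum f L ≡ multiplicity zero L · f zero ∙ blockSum (λ i → f (suc i)) (map tail L)
  blockSum-decompose f [] = sym (identityˡ ε)
  blockSum-decompose f ((b ∷ B) ∷ L) = begin
      ((if b then f zero else ε) ∙ subsetSum f′ B) ∙ blockSum f L
        ≡⟨ cong₂ (λ y z → (y ∙ subsetSum f′ B) ∙ z) (head b) (blockSum-decompose f L) ⟩
      (indicator (b ∷ B) zero · f zero ∙ subsetSum f′ B) ∙ (multiplicity zero L · f zero ∙ blockSum f′ (map tail L))
        ≡⟨ interchange _ _ _ _ ⟩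
      (indicator (b ∷ B) zero · f zero ∙ multiplicity zero L · f zero) ∙ (subsetSum f′ B ∙ blockSum f′ (map tail L))
        ≡⟨ cong (_∙ (subsetSum f′ B ∙ blockSum f′ (map tail L))) (sym (·-homo-+ (f zero) (indicator (b ∷ B) zero) (multiplicity zero L))) ⟩
      (indicator (b ∷ B) zero ℕ.+ multiplicity zero L) · f zero ∙ (subsetSum f′ B ∙ blockSum f′ (map tail L)) ∎
    where
      open ≡-Reasoning
      f′ = λ i → f (suc i)
      head : ∀ b → (if b then f zero else ε) ≡ indicator (b ∷ B) zero · f zero
      head true  = sym (identityʳ _)
      head false = refl

  blockSum-mono : ∀ {m} (f : Fin m → Carrier) → (∀ i → ε ≤ f i) → ∀ L L′ →
    (∀ x → multiplicity x L ℕ.≤ multiplicity x L′) → blockSum f L ≤ blockSum f L′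
  blockSum-mono {zero} f f≥0 L L′ _ =
    subst₂ _≤_ (sym (blockSum-empty f L)) (sym (blockSum-empty f L′)) ≤-refl
  blockSum-mono {suc m} f f≥0 L L′ mult≤ =
    subst₂ _≤_ (sym (blockSum-decompose f L)) (sym (blockSum-decompose f L′))
      (∙-mono-≤ (·-monoˡ-≤ (f zero) (f≥0 zero) (mult≤ zero))
                (blockSum-mono (λ i → f (suc i)) (λ i → f≥0 (suc i)) (map tail L) (map tail L′)
                   (λ x → subst₂ ℕ._≤_ (multiplicity-suc x L) (multiplicity-suc x L′) (mult≤ (suc x)))))

  blockSum-cong : ∀ {m} (f : Fin m → Carrier) → (∀ i → ε ≤ f i) → ∀ L L′ →
    (∀ x → multiplicity x L ≡ multiplicity x L′) → blockSum f L ≡ blockSum f L′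
  blockSum-cong f f≥0 L L′ mult≡ =
    antisym (blockSum-mono f f≥0 L L′ (λ x → ℕ.≤-reflexive (mult≡ x)))
            (blockSum-mono f f≥0 L′ L (λ x → ℕ.≤-reflexive (sym (mult≡ x))))

module _ where
  open import Data.Nat using (_+_; _*_; _≤_; _<_)

  ℕ-orderedCommutativeMonoid : OrderedCommutativeMonoid
  ℕ-orderedCommutativeMonoid = record
    { Carrier = ℕ ; _≤_ = _≤_ ; _∙_ = _+_ ; ε = 0
    ; isCommutativeMonoid = ℕ.+-0-isCommutativeMonoid
    ; ≤-isPartialOrder = ℕ.≤-isPartialOrder
    ; ∙-mono-≤ = ℕ.+-mono-≤
    }

  module ℕ-Sums = SubsetSums ℕ-orderedCommutativeMonoid

  count : ∀ {m} {P : Fin m → Set} → (∀ x → Dec (P x)) → Subset m → ℕ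
  count P? = ℕ-Sums.subsetSum (λ x → 𝟙 (P? x))

  count-none : ∀ {m} {P : Fin m → Set} (P? : ∀ x → Dec (P x)) B → (∀ x → x ∈ B → ¬ P x) → count P? B ≡ 0
  count-none {zero}  P? []            _    = refl
  count-none {suc m} P? (inside ∷ B)  none = cong₂ _+_ (𝟙-no (P? zero) (none zero ∈-zero)) (count-none (P? ∘ suc) B (λ x → none (suc x) ∘ ∈-suc))
  count-none {suc m} P? (outside ∷ B) none = count-none (P? ∘ suc) B (λ x → none (suc x) ∘ ∈-suc)

  count≤1 : ∀ {m} {P : Fin m → Set} (P? : ∀ x → Dec (P x)) B → (∀ {x y} → x ∈ B → y ∈ B → P x → P y → x ≡ y) → count P? B ≤ 1
  count≤1 {zero}  P? []            _ = z≤n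
  count≤1 {suc m} P? (outside ∷ B) unique = count≤1 (P? ∘ suc) B λ x∈B y∈B px py → suc-injective (unique (∈-suc x∈B) (∈-suc y∈B) px py)
  count≤1 {suc m} P? (inside ∷ B)  unique with P? zero
  ... | no _ = count≤1 (P? ∘ suc) B λ x∈B y∈B px py → suc-injective (unique (∈-suc x∈B) (∈-suc y∈B) px py)
  ... | yes p0 = ℕ.≤-reflexive (cong suc (count-none (P? ∘ suc) B λ x x∈B px → 0≢1+n (unique ∈-zero (∈-suc x∈B) p0 px)))

  count≥1 : ∀ {m} {P : Fin m → Set} (P? : ∀ x → Dec (P x)) {B x} → x ∈ B → P x → 1 ≤ count P? B
  count≥1 P? {B} {x} x∈B px = begin
    1                                         ≡⟨ 𝟙-yes (P? x) px ⟨
    𝟙 (P? x)                                  ≡⟨ ℕ-Sums.subsetSum-⁅⁆ _ x ⟨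
    count P? ⁅ x ⁆                            ≡⟨ ℕ-Sums.blockSum-[ ⁅ x ⁆ ] ⟨
    ℕ-Sums.blockSum (𝟙 ∘ P?) (⁅ x ⁆ ∷ [])    ≤⟨ ℕ-Sums.blockSum-mono (𝟙 ∘ P?) (λ _ → z≤n) (⁅ x ⁆ ∷ []) (B ∷ [])
                                                    (λ y → ℕ.+-monoˡ-≤ 0 (indicator-⁅⁆≤ x∈B y)) ⟩
    ℕ-Sums.blockSum (𝟙 ∘ P?) (B ∷ [])        ≡⟨ ℕ-Sums.blockSum-[ B ] ⟩
    count P? B                                ∎
    where open ℕ.≤-Reasoning

  -- Each block of L owns a P-point, distinct ones as L is disjoint, and no block of Q holds two.
  hitting-disjoint≤separating-cover : ∀ {m} {P : Fin m → Set} (P? : ∀ x → Dec (P x)) (L Q : List (Subset m)) →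
    All (λ B → ∃ λ x → x ∈ B × P x) L → (∀ x → multiplicity x L ≤ 1) →
    (∀ x → Any (x ∈_) Q) → All (λ B → ∀ {x y} → x ∈ B → y ∈ B → P x → P y → x ≡ y) Q →
    length L ≤ length Q
  hitting-disjoint≤separating-cover {m} {P} P? L Q hitting disjoint covering separating = begin
    length L                 ≤⟨ length≤blockSum L hitting ⟩
    blockSum χ L             ≤⟨ blockSum-mono χ (λ _ → z≤n) L (⊤ ∷ []) (λ x → ℕ.≤-trans (disjoint x) (ℕ.≤-reflexive (sym (multiplicity-[⊤] x)))) ⟩
    blockSum χ (⊤ ∷ [])      ≤⟨ blockSum-mono χ (λ _ → z≤n) (⊤ ∷ []) Q (λ x → Any⇒multiplicity-[⊤]≤ (covering x)) ⟩
    blockSum χ Q             ≤⟨ blockSum≤length Q separating ⟩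
    length Q                 ∎
    where
      open ℕ.≤-Reasoning
      open ℕ-Sums using (blockSum; blockSum-mono)
      χ : Fin m → ℕ
      χ x = 𝟙 (P? x)
      length≤blockSum : ∀ L → All (λ B → ∃ λ x → x ∈ B × P x) L → length L ≤ blockSum χ L
      length≤blockSum []      []                      = z≤n
      length≤blockSum (B ∷ L) ((x , x∈B , px) ∷ hit) = ℕ.+-mono-≤ (count≥1 P? x∈B px) (length≤blockSum L hit)
      blockSum≤length : ∀ Q → All (λ B → ∀ {x y} → x ∈ B → y ∈ B → P x → P y → x ≡ y) Q → blockSum χ Q ≤ length Q
      blockSum≤length []      []          = z≤n
      blockSum≤length (B ∷ Q) (sep ∷ seps) = ℕ.+-mono-≤ (count≤1 P? B sep) (blockSum≤length Q seps)

  private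
    expand-without-rest : ∀ p₁ b₁ p₂ b₂ → 2 * (p₁ + (b₁ + (p₂ + (b₂ + 0)))) ≡ 2 * p₁ + 2 * b₁ + 2 * (p₂ + b₂)
    expand-without-rest = solve-∀

    collect-without-rest : ∀ p₁ b₁ b₂ → 2 * p₁ + 2 * b₁ + (p₁ + b₂) ≡ 3 * p₁ + (2 * b₁ + b₂)
    collect-without-rest = solve-∀

    expand-with-rest : ∀ p₁ b₁ p₂ b₂ r → 2 * (p₁ + (b₁ + (p₂ + (b₂ + r)))) ≡ 2 * (p₁ + (b₁ + r)) + 2 * (p₂ + b₂)
    expand-with-rest = solve-∀

    three-times : ∀ q → 2 * q + q ≡ 3 * q
    three-times = solve-∀

  -- p₁, b₁, p₂, b₂, r count the blocks of P₁, ⟦B₁⟧, P₂, ⟦B₂⟧ and the leftover singletons; q = |Q|.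
  three-halves-bound : ∀ p₁ b₁ p₂ b₂ r q → p₁ < q → 2 * (p₂ + b₂) ≤ p₁ + b₂ → b₁ ≤ 1 → b₂ ≤ 1 →
    (1 ≤ r → p₁ + (b₁ + r) ≤ q) → 2 * (p₁ + (b₁ + (p₂ + (b₂ + r)))) ≤ 3 * q
  three-halves-bound p₁ b₁ p₂ b₂ zero q p₁<q P₂-bound b₁≤1 b₂≤1 _ = begin
    2 * (p₁ + (b₁ + (p₂ + (b₂ + 0))))  ≡⟨ expand-without-rest p₁ b₁ p₂ b₂ ⟩
    2 * p₁ + 2 * b₁ + 2 * (p₂ + b₂)    ≤⟨ ℕ.+-monoʳ-≤ (2 * p₁ + 2 * b₁) P₂-bound ⟩
    2 * p₁ + 2 * b₁ + (p₁ + b₂)        ≡⟨ collect-without-rest p₁ b₁ b₂ ⟩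
    3 * p₁ + (2 * b₁ + b₂)             ≤⟨ ℕ.+-monoʳ-≤ (3 * p₁) (ℕ.+-mono-≤ (ℕ.*-monoʳ-≤ 2 b₁≤1) b₂≤1) ⟩
    3 * p₁ + 3                         ≡⟨ ℕ.+-comm (3 * p₁) 3 ⟩
    3 + 3 * p₁                         ≡⟨ ℕ.*-suc 3 p₁ ⟨
    3 * suc p₁                         ≤⟨ ℕ.*-monoʳ-≤ 3 p₁<q ⟩
    3 * q                              ∎
    where open ℕ.≤-Reasoning
  three-halves-bound p₁ b₁ p₂ b₂ r@(suc _) q p₁<q P₂-bound b₁≤1 b₂≤1 first-bound = begin
    2 * (p₁ + (b₁ + (p₂ + (b₂ + r))))   ≡⟨ expand-with-rest p₁ b₁ p₂ b₂ r ⟩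
    2 * (p₁ + (b₁ + r)) + 2 * (p₂ + b₂) ≤⟨ ℕ.+-mono-≤ (ℕ.*-monoʳ-≤ 2 (first-bound (s≤s z≤n))) P₂-bound ⟩
    2 * q + (p₁ + b₂)                   ≤⟨ ℕ.+-monoʳ-≤ (2 * q) (ℕ.≤-trans (ℕ.+-monoʳ-≤ p₁ b₂≤1) (ℕ.≤-trans (ℕ.≤-reflexive (ℕ.+-comm p₁ 1)) p₁<q)) ⟩
    2 * q + q                           ≡⟨ three-times q ⟩
    3 * q                               ∎
    where open ℕ.≤-Reasoning

module OrderedFieldProperties (ℝ : RealNumbers) where
  open RealNumbers ℝ
  open IsCommutativeRing isCommutativeRing
    using (+-comm; +-isCommutativeMonoid; distribˡ; distribʳ; *-identityˡ; *-identityʳ)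
  open IsStrictTotalOrder isStrictTotalOrder using (irrefl; isStrictPartialOrder) renaming (trans to <-trans)

  <-strictPartialOrder : StrictPartialOrder 0ℓ 0ℓ 0ℓ
  <-strictPartialOrder = record { isStrictPartialOrder = isStrictPartialOrder }

  module <-Reasoning = StrictPartialOrderReasoning <-strictPartialOrder

  <-irrefl : ∀ {x} → ¬ x < x
  <-irrefl = irrefl refl

  ≤-isPartialOrder : IsPartialOrder _≡_ _≤_
  ≤-isPartialOrder = StrictToNonStrict.isPartialOrder _≡_ _<_ isStrictPartialOrder

  open IsPartialOrder ≤-isPartialOrder public using () renaming (refl to ≤-refl; trans to ≤-trans)

  <-≤-trans : ∀ {x y z} → x < y → y ≤ z → x < z
  <-≤-trans x<y (inj₁ y<z)  = <-trans x<y y<z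
  <-≤-trans x<y (inj₂ refl) = x<y

  ≰⇒> : ∀ {x y} → ¬ x ≤ y → y < x
  ≰⇒> {x} {y} x≰y with compare x y
  ... | tri< x<y _ _ = ⊥-elim (x≰y (inj₁ x<y))
  ... | tri≈ _ x≡y _ = ⊥-elim (x≰y (inj₂ x≡y))
  ... | tri> _ _ y<x = y<x

  +-monoʳ-< : ∀ z {x y} → x < y → z + x < z + y
  +-monoʳ-< z {x} {y} x<y = subst₂ _<_ (+-comm x z) (+-comm y z) (+-mono-< z x<y)

  +-monoˡ-≤ : ∀ z {x y} → x ≤ y → x + z ≤ y + z
  +-monoˡ-≤ z (inj₁ x<y)  = inj₁ (+-mono-< z x<y)
  +-monoˡ-≤ z (inj₂ refl) = ≤-refl

  +-monoʳ-≤ : ∀ z {x y} → x ≤ y → z + x ≤ z + y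
  +-monoʳ-≤ z (inj₁ x<y)  = inj₁ (+-monoʳ-< z x<y)
  +-monoʳ-≤ z (inj₂ refl) = ≤-refl

  +-mono-≤ : ∀ {x y u v} → x ≤ y → u ≤ v → x + u ≤ y + v
  +-mono-≤ {y = y} {u} x≤y u≤v = ≤-trans (+-monoˡ-≤ u x≤y) (+-monoʳ-≤ y u≤v)

  +-mono-<-≤ : ∀ {x y u v} → x < y → u ≤ v → x + u < y + v
  +-mono-<-≤ {y = y} {u} x<y u≤v = <-≤-trans (+-mono-< u x<y) (+-monoʳ-≤ y u≤v)

  +-mono-<-< : ∀ {x y u v} → x < y → u < v → x + u < y + v
  +-mono-<-< x<y u<v = +-mono-<-≤ x<y (inj₁ u<v)

  half+half : ∀ x → half x + half x ≡ x
  half+half x = begin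
    x * ½ + x * ½          ≡⟨ distribˡ x ½ ½ ⟨
    x * (½ + ½)            ≡⟨ cong (x *_) (cong₂ _+_ (*-identityˡ ½) (*-identityˡ ½)) ⟨
    x * (1# * ½ + 1# * ½)  ≡⟨ cong (x *_) (distribʳ ½ 1# 1#) ⟨
    x * (two * ½)          ≡⟨ cong (x *_) (proj₂ (inverse two two≢0)) ⟩
    x * 1#                 ≡⟨ *-identityʳ x ⟩
    x                      ∎
    where
      open ≡-Reasoning
      ½ = proj₁ (inverse two two≢0)

  +-orderedCommutativeMonoid : OrderedCommutativeMonoid
  +-orderedCommutativeMonoid = record
    { Carrier = Carrier ; _≤_ = _≤_ ; _∙_ = _+_ ; ε = 0#
    ; isCommutativeMonoid = +-isCommutativeMonoid
    ; ≤-isPartialOrder = ≤-isPartialOrder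
    ; ∙-mono-≤ = +-mono-≤
    }

module Analysis (ℝ : RealNumbers) {n : ℕ} (c : ℕ) (w : Fin n → RealNumbers.Carrier ℝ)
  (w-pos : ∀ u → RealNumbers._<_ ℝ (RealNumbers.0# ℝ) (w u))
  (w≤c : ∀ u → RealNumbers._≤_ ℝ (w u) (RealNumbers.fromℕ ℝ c))
  (x₀ : Fin n) where
  -- x₀ witnesses U ≠ ∅: it gives c ≥ 0 and rules out an empty packing Q.
  open BinPacking ℝ c w
  open import Relation.Binary.Construct.Closure.ReflexiveTransitive using (Star; ε; _◅_; _◅◅_)

  reachable-invariant : (I : State → Set) → I initial →
    (∀ {s s′} → Reachable s → I s → Step s s′ → I s′) → ∀ {s} → Reachable s → I s
  reachable-invariant I I₀ preserved = go ε I₀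
    where
      go : ∀ {s s′} → Reachable s → I s → Star Step s s′ → I s′
      go r i ε          = i
      go r i (st ◅ sts) = go (r ◅◅ st ◅ ε) (preserved r i st) sts

  multiplicity-⟦⟧ : ∀ x B → multiplicity x ⟦ B ⟧ ≡ indicator B x
  multiplicity-⟦⟧ x B with nonempty? B
  ... | yes _  = ℕ.+-identityʳ _
  ... | no ∄x∈B = sym (𝟙-no (x ∈? B) (λ x∈B → ∄x∈B (x , x∈B)))

  multiplicity-++-⟦⟧ : ∀ x L B → multiplicity x (L ++ ⟦ B ⟧) ≡ multiplicity x L ℕ.+ indicator B x
  multiplicity-++-⟦⟧ x L B = trans (multiplicity-++ x L ⟦ B ⟧) (cong (multiplicity x L ℕ.+_) (multiplicity-⟦⟧ x B))

  All-⟦⟧ : ∀ {P : Subset n → Set} {B} → (Nonempty B → P B) → All P ⟦ B ⟧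
  All-⟦⟧ {B = B} p with nonempty? B
  ... | yes ∃x∈B = p ∃x∈B ∷ []
  ... | no _     = []

  length-⟦⟧ : ∀ {B} → Nonempty B → length ⟦ B ⟧ ≡ 1
  length-⟦⟧ {B} ∃x∈B with nonempty? B
  ... | yes _    = refl
  ... | no ∄x∈B = ⊥-elim (∄x∈B ∃x∈B)

  length-⟦⟧-empty : ∀ {B} → Empty B → length ⟦ B ⟧ ≡ 0
  length-⟦⟧-empty {B} ∄x∈B with nonempty? B
  ... | yes ∃x∈B = ⊥-elim (∄x∈B ∃x∈B)
  ... | no _     = refl

  length-⟦⟧≤1 : ∀ B → length ⟦ B ⟧ ℕ.≤ 1
  length-⟦⟧≤1 B with nonempty? B
  ... | yes _ = s≤s z≤n
  ... | no _  = z≤n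

  length-++-⟦⟧ : ∀ L {B} → Nonempty B → length (L ++ ⟦ B ⟧) ≡ suc (length L)
  length-++-⟦⟧ L ∃x∈B = trans (length-++ L) (trans (cong (length L ℕ.+_) (length-⟦⟧ ∃x∈B)) (ℕ.+-comm (length L) 1))

  All-singletons : ∀ {P : Subset n → Set} V → (∀ v → P ⁅ v ⁆) → All P (singletons V)
  All-singletons V P⁅⁆ = map⁺ (universal P⁅⁆ _)

  member-of-singletons : ∀ V → 1 ℕ.≤ length (singletons V) → ∃ (_∈ V)
  member-of-singletons V 1≤r with filter (_∈? V) (allFin n) | all-filter (_∈? V) (allFin n)
  ... | v ∷ _ | v∈V ∷ _ = v , v∈V

  module Partitioning where
    open import Data.Nat using (_+_; _≤_)

    tally : State → Fin n → ℕ
    tally s x = multiplicity x (P₁ s) + multiplicity x (P₂ s) + indicator (B₁ s) x + indicator (B₂ s) x + indicator (V s) x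

    record Partition (s : State) : Set where
      constructor partition
      field covers-once : ∀ x → tally s x ≡ 1
    open Partition public

    B₁+V≤tally : ∀ s x → indicator (B₁ s) x + indicator (V s) x ≤ tally s x
    B₁+V≤tally s x = ℕ.+-monoˡ-≤ (indicator (V s) x)
      (ℕ.≤-trans (ℕ.m≤n+m (indicator (B₁ s) x) (multiplicity x (P₁ s) + multiplicity x (P₂ s))) (ℕ.m≤m+n _ (indicator (B₂ s) x)))

    B₂+V≤tally : ∀ s x → indicator (B₂ s) x + indicator (V s) x ≤ tally s x
    B₂+V≤tally s x = ℕ.+-monoˡ-≤ (indicator (V s) x)
      (ℕ.m≤n+m (indicator (B₂ s) x) (multiplicity x (P₁ s) + multiplicity x (P₂ s) + indicator (B₁ s) x))

    private
      twice≤tally⇒¬partition : ∀ {s x i j} → i + j ≤ tally s x → i ≡ 1 → j ≡ 1 → ¬ Partition s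
      twice≤tally⇒¬partition {x = x} ≤tally refl refl part with subst (2 ≤_) (covers-once part x) ≤tally
      ... | s≤s ()

    ∈V⇒∉B₁ : ∀ {s u} → Partition s → u ∈ V s → u ∉ B₁ s
    ∈V⇒∉B₁ {s} {u} part u∈V u∈B₁ =
      twice≤tally⇒¬partition {s} {u} (B₁+V≤tally s u) (𝟙-yes (u ∈? B₁ s) u∈B₁) (𝟙-yes (u ∈? V s) u∈V) part

    ∈V⇒∉B₂ : ∀ {s u} → Partition s → u ∈ V s → u ∉ B₂ s
    ∈V⇒∉B₂ {s} {u} part u∈V u∈B₂ =
      twice≤tally⇒¬partition {s} {u} (B₂+V≤tally s u) (𝟙-yes (u ∈? B₂ s) u∈B₂) (𝟙-yes (u ∈? V s) u∈V) part

    private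
      rearrange-fit₁ : ∀ p₁ p₂ b₁ b₂ v′ u′ → p₁ + p₂ + (b₁ + u′) + b₂ + v′ ≡ p₁ + p₂ + b₁ + b₂ + (v′ + u′)
      rearrange-fit₁ = solve-∀

      rearrange-fit₂ : ∀ p₁ p₂ b₁ b₂ v′ u′ → (p₁ + b₁) + p₂ + 0 + (b₂ + u′) + v′ ≡ p₁ + p₂ + b₁ + b₂ + (v′ + u′)
      rearrange-fit₂ = solve-∀

      rearrange-new₂ : ∀ p₁ p₂ b₁ b₂ v′ u′ → (p₁ + b₁) + (p₂ + b₂) + 0 + u′ + v′ ≡ p₁ + p₂ + b₁ + b₂ + (v′ + u′)
      rearrange-new₂ = solve-∀

    tally-step : ∀ {s s′} → Partition s → Step s s′ → ∀ x → tally s′ x ≡ tally s x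
    tally-step part (fit₁ {P₁} {P₂} {B₁} {B₂} {V} u _ (u∈V , _) _) x = begin
        p₁ + p₂ + indicator (B₁ ∪ ⁅ u ⁆) x + b₂ + v′
          ≡⟨ cong (λ i → p₁ + p₂ + i + b₂ + v′) (indicator-∪-⁅⁆ (∈V⇒∉B₁ part u∈V) x) ⟩
        p₁ + p₂ + (b₁ + u′) + b₂ + v′
          ≡⟨ rearrange-fit₁ p₁ p₂ b₁ b₂ v′ u′ ⟩
        p₁ + p₂ + b₁ + b₂ + (v′ + u′)
          ≡⟨ cong (p₁ + p₂ + b₁ + b₂ +_) (indicator-─-⁅⁆ u∈V x) ⟩
        p₁ + p₂ + b₁ + b₂ + v ∎
      where
        open ≡-Reasoning
        p₁ = multiplicity x P₁
        p₂ = multiplicity x P₂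
        b₁ = indicator B₁ x
        b₂ = indicator B₂ x
        v  = indicator V x
        v′ = indicator (V - u) x
        u′ = indicator ⁅ u ⁆ x
    tally-step part (fit₂ {P₁} {P₂} {B₁} {B₂} {V} u _ (u∈V , _) _ _) x = begin
        multiplicity x (P₁ ++ ⟦ B₁ ⟧) + p₂ + indicator ⊥ x + indicator (B₂ ∪ ⁅ u ⁆) x + v′
          ≡⟨ cong₂ (λ p i → p + p₂ + indicator ⊥ x + i + v′) (multiplicity-++-⟦⟧ x P₁ B₁) (indicator-∪-⁅⁆ (∈V⇒∉B₂ part u∈V) x) ⟩
        (p₁ + b₁) + p₂ + indicator ⊥ x + (b₂ + u′) + v′
          ≡⟨ cong (λ o → (p₁ + b₁) + p₂ + o + (b₂ + u′) + v′) (indicator-⊥ x) ⟩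
        (p₁ + b₁) + p₂ + 0 + (b₂ + u′) + v′
          ≡⟨ rearrange-fit₂ p₁ p₂ b₁ b₂ v′ u′ ⟩
        p₁ + p₂ + b₁ + b₂ + (v′ + u′)
          ≡⟨ cong (p₁ + p₂ + b₁ + b₂ +_) (indicator-─-⁅⁆ u∈V x) ⟩
        p₁ + p₂ + b₁ + b₂ + v ∎
      where
        open ≡-Reasoning
        p₁ = multiplicity x P₁
        p₂ = multiplicity x P₂
        b₁ = indicator B₁ x
        b₂ = indicator B₂ x
        v  = indicator V x
        v′ = indicator (V - u) x
        u′ = indicator ⁅ u ⁆ x
    tally-step part (new₂ {P₁} {P₂} {B₁} {B₂} {V} u _ (u∈V , _) _ _) x = begin
        multiplicity x (P₁ ++ ⟦ B₁ ⟧) + multiplicity x (P₂ ++ ⟦ B₂ ⟧) + indicator ⊥ x + u′ + v′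
          ≡⟨ cong₂ (λ p q → p + q + indicator ⊥ x + u′ + v′) (multiplicity-++-⟦⟧ x P₁ B₁) (multiplicity-++-⟦⟧ x P₂ B₂) ⟩
        (p₁ + b₁) + (p₂ + b₂) + indicator ⊥ x + u′ + v′
          ≡⟨ cong (λ o → (p₁ + b₁) + (p₂ + b₂) + o + u′ + v′) (indicator-⊥ x) ⟩
        (p₁ + b₁) + (p₂ + b₂) + 0 + u′ + v′
          ≡⟨ rearrange-new₂ p₁ p₂ b₁ b₂ v′ u′ ⟩
        p₁ + p₂ + b₁ + b₂ + (v′ + u′)
          ≡⟨ cong (p₁ + p₂ + b₁ + b₂ +_) (indicator-─-⁅⁆ u∈V x) ⟩
        p₁ + p₂ + b₁ + b₂ + v ∎
      where
        open ≡-Reasoning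
        p₁ = multiplicity x P₁
        p₂ = multiplicity x P₂
        b₁ = indicator B₁ x
        b₂ = indicator B₂ x
        v  = indicator V x
        v′ = indicator (V - u) x
        u′ = indicator ⁅ u ⁆ x

    private
      rearrange-cover-fit₂ : ∀ p₁ p₂ b₁ b₂ u′ → (b₂ + u′) + ((p₁ + b₁) + p₂) ≡ b₁ + (u′ + (b₂ + (p₁ + p₂)))
      rearrange-cover-fit₂ = solve-∀

      rearrange-cover-new₂ : ∀ p₁ p₂ b₁ b₂ u′ → u′ + ((p₁ + b₁) + (p₂ + b₂)) ≡ b₁ + (u′ + (b₂ + (p₁ + p₂)))
      rearrange-cover-new₂ = solve-∀

    cover-after-fit₂ : ∀ {P₁ P₂ B₁ B₂ u} → u ∉ B₂ → ∀ x →
      multiplicity x (B₂ ∪ ⁅ u ⁆ ∷ (P₁ ++ ⟦ B₁ ⟧) ++ P₂) ≡ multiplicity x (B₁ ∷ ⁅ u ⁆ ∷ B₂ ∷ P₁ ++ P₂)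
    cover-after-fit₂ {P₁} {P₂} {B₁} {B₂} {u} u∉B₂ x = begin
      indicator (B₂ ∪ ⁅ u ⁆) x + multiplicity x ((P₁ ++ ⟦ B₁ ⟧) ++ P₂)
        ≡⟨ cong₂ _+_ (indicator-∪-⁅⁆ u∉B₂ x)
                     (trans (multiplicity-++ x (P₁ ++ ⟦ B₁ ⟧) P₂) (cong (_+ p₂) (multiplicity-++-⟦⟧ x P₁ B₁))) ⟩
      (b₂ + u′) + ((p₁ + b₁) + p₂)
        ≡⟨ rearrange-cover-fit₂ p₁ p₂ b₁ b₂ u′ ⟩
      b₁ + (u′ + (b₂ + (p₁ + p₂)))
        ≡⟨ cong (λ m → b₁ + (u′ + (b₂ + m))) (multiplicity-++ x P₁ P₂) ⟨
      b₁ + (u′ + (b₂ + multiplicity x (P₁ ++ P₂))) ∎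
      where
        open ≡-Reasoning
        p₁ = multiplicity x P₁
        p₂ = multiplicity x P₂
        b₁ = indicator B₁ x
        b₂ = indicator B₂ x
        u′ = indicator ⁅ u ⁆ x

    cover-after-new₂ : ∀ {P₁ P₂ B₁ B₂} u x →
      multiplicity x (⁅ u ⁆ ∷ (P₁ ++ ⟦ B₁ ⟧) ++ (P₂ ++ ⟦ B₂ ⟧)) ≡ multiplicity x (B₁ ∷ ⁅ u ⁆ ∷ B₂ ∷ P₁ ++ P₂)
    cover-after-new₂ {P₁} {P₂} {B₁} {B₂} u x = begin
      u′ + multiplicity x ((P₁ ++ ⟦ B₁ ⟧) ++ (P₂ ++ ⟦ B₂ ⟧))
        ≡⟨ cong (u′ +_) (trans (multiplicity-++ x (P₁ ++ ⟦ B₁ ⟧) (P₂ ++ ⟦ B₂ ⟧))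
                               (cong₂ _+_ (multiplicity-++-⟦⟧ x P₁ B₁) (multiplicity-++-⟦⟧ x P₂ B₂))) ⟩
      u′ + ((p₁ + b₁) + (p₂ + b₂))
        ≡⟨ rearrange-cover-new₂ p₁ p₂ b₁ b₂ u′ ⟩
      b₁ + (u′ + (b₂ + (p₁ + p₂)))
        ≡⟨ cong (λ m → b₁ + (u′ + (b₂ + m))) (multiplicity-++ x P₁ P₂) ⟨
      b₁ + (u′ + (b₂ + multiplicity x (P₁ ++ P₂))) ∎
      where
        open ≡-Reasoning
        p₁ = multiplicity x P₁
        p₂ = multiplicity x P₂
        b₁ = indicator B₁ x
        b₂ = indicator B₂ x
        u′ = indicator ⁅ u ⁆ x

    private
      rearrange-output : ∀ p₁ p₂ b₁ b₂ v → p₁ + (b₁ + (p₂ + (b₂ + v))) ≡ p₁ + p₂ + b₁ + b₂ + v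
      rearrange-output = solve-∀

      rearrange-open-B₂ : ∀ p₁ p₂ b₁ b₂ v → p₁ + p₂ + b₁ + b₂ + v ≡ (b₂ + (p₁ + p₂)) + (b₁ + v)
      rearrange-open-B₂ = solve-∀

      rearrange-first : ∀ p₁ p₂ b₁ b₂ v → p₁ + p₂ + b₁ + b₂ + v ≡ (p₁ + (b₁ + v)) + (p₂ + b₂)
      rearrange-first = solve-∀

    multiplicity-output : ∀ s x → multiplicity x (output s) ≡ tally s x
    multiplicity-output ⟨ P₁ , P₂ , B₁ , B₂ , V ⟩ x = begin
      multiplicity x (P₁ ++ ⟦ B₁ ⟧ ++ P₂ ++ ⟦ B₂ ⟧ ++ singletons V)
        ≡⟨ multiplicity-++ x P₁ _ ⟩
      p₁ + multiplicity x (⟦ B₁ ⟧ ++ P₂ ++ ⟦ B₂ ⟧ ++ singletons V)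
        ≡⟨ cong (p₁ +_) (trans (multiplicity-++ x ⟦ B₁ ⟧ _) (cong₂ _+_ (multiplicity-⟦⟧ x B₁) (multiplicity-++ x P₂ _))) ⟩
      p₁ + (b₁ + (p₂ + multiplicity x (⟦ B₂ ⟧ ++ singletons V)))
        ≡⟨ cong (λ m → p₁ + (b₁ + (p₂ + m)))
                (trans (multiplicity-++ x ⟦ B₂ ⟧ _) (cong₂ _+_ (multiplicity-⟦⟧ x B₂) (multiplicity-singletons V x))) ⟩
      p₁ + (b₁ + (p₂ + (b₂ + v)))
        ≡⟨ rearrange-output p₁ p₂ b₁ b₂ v ⟩
      tally ⟨ P₁ , P₂ , B₁ , B₂ , V ⟩ x ∎
      where
        open ≡-Reasoning
        p₁ = multiplicity x P₁
        p₂ = multiplicity x P₂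
        b₁ = indicator B₁ x
        b₂ = indicator B₂ x
        v  = indicator V x

    multiplicity-B₂P₁P₂≤tally : ∀ s x → multiplicity x (B₂ s ∷ P₁ s ++ P₂ s) ≤ tally s x
    multiplicity-B₂P₁P₂≤tally ⟨ P₁ , P₂ , B₁ , B₂ , V ⟩ x = begin
      indicator B₂ x + multiplicity x (P₁ ++ P₂)           ≡⟨ cong (indicator B₂ x +_) (multiplicity-++ x P₁ P₂) ⟩
      b₂ + (p₁ + p₂)                                      ≤⟨ ℕ.m≤m+n _ (b₁ + v) ⟩
      (b₂ + (p₁ + p₂)) + (b₁ + v)                         ≡⟨ rearrange-open-B₂ p₁ p₂ b₁ b₂ v ⟨
      tally ⟨ P₁ , P₂ , B₁ , B₂ , V ⟩ x                   ∎
      where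
        open ℕ.≤-Reasoning
        p₁ = multiplicity x P₁
        p₂ = multiplicity x P₂
        b₁ = indicator B₁ x
        b₂ = indicator B₂ x
        v  = indicator V x

    multiplicity-P₁B₁V≤tally : ∀ s x → multiplicity x (P₁ s ++ ⟦ B₁ s ⟧ ++ singletons (V s)) ≤ tally s x
    multiplicity-P₁B₁V≤tally ⟨ P₁ , P₂ , B₁ , B₂ , V ⟩ x = begin
      multiplicity x (P₁ ++ ⟦ B₁ ⟧ ++ singletons V)
        ≡⟨ multiplicity-++ x P₁ _ ⟩
      p₁ + multiplicity x (⟦ B₁ ⟧ ++ singletons V)
        ≡⟨ cong (p₁ +_) (trans (multiplicity-++ x ⟦ B₁ ⟧ _) (cong₂ _+_ (multiplicity-⟦⟧ x B₁) (multiplicity-singletons V x))) ⟩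
      p₁ + (b₁ + v)                     ≤⟨ ℕ.m≤m+n _ (p₂ + b₂) ⟩
      (p₁ + (b₁ + v)) + (p₂ + b₂)       ≡⟨ rearrange-first p₁ p₂ b₁ b₂ v ⟨
      tally ⟨ P₁ , P₂ , B₁ , B₂ , V ⟩ x ∎
      where
        open ℕ.≤-Reasoning
        p₁ = multiplicity x P₁
        p₂ = multiplicity x P₂
        b₁ = indicator B₁ x
        b₂ = indicator B₂ x
        v  = indicator V x

    partition-initial : Partition initial
    partition-initial = partition λ x → cong₂ (λ o t → o + o + t) (indicator-⊥ x) (indicator-⊤ x)

    reachable⇒partition : ∀ {s} → Reachable s → Partition s
    reachable⇒partition = reachable-invariant Partition partition-initial
      (λ _ part st → partition λ x → trans (tally-step part st x) (covers-once part x))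

  module Weights where
    open RealNumbers ℝ using (Carrier; 0#; _+_; _<_; _≤_; half; compare)
    open OrderedFieldProperties ℝ
    open SubsetSums +-orderedCommutativeMonoid
    open OrderedCommutativeMonoid +-orderedCommutativeMonoid using (identityˡ; identityʳ)

    w≥0 : ∀ u → 0# ≤ w u
    w≥0 u = inj₁ (w-pos u)

    cap≥0 : 0# ≤ cap
    cap≥0 = ≤-trans (w≥0 x₀) (w≤c x₀)

    Wgt≡subsetSum : ∀ {m} (f : Fin m → Carrier) B → Wgt f B ≡ subsetSum f B
    Wgt≡subsetSum {zero}  f []      = refl
    Wgt≡subsetSum {suc m} f (b ∷ B) = cong (_ +_) (Wgt≡subsetSum (f ∘ suc) B)

    W≡blockSum : ∀ B → W B ≡ blockSum w (B ∷ [])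
    W≡blockSum B = trans (Wgt≡subsetSum w B) (sym blockSum-[ B ])

    W-⊥ : W ⊥ ≡ 0#
    W-⊥ = trans (Wgt≡subsetSum w ⊥) (subsetSum-⊥ w)

    W-⁅⁆ : ∀ u → W ⁅ u ⁆ ≡ w u
    W-⁅⁆ u = trans (Wgt≡subsetSum w ⁅ u ⁆) (subsetSum-⁅⁆ w u)

    W-∪-⁅⁆ : ∀ {B u} → u ∉ B → W (B ∪ ⁅ u ⁆) ≡ W B + w u
    W-∪-⁅⁆ {B} {u} u∉B = begin
      W (B ∪ ⁅ u ⁆)                      ≡⟨ W≡blockSum (B ∪ ⁅ u ⁆) ⟩
      blockSum w (B ∪ ⁅ u ⁆ ∷ [])        ≡⟨ blockSum-cong w w≥0 (B ∪ ⁅ u ⁆ ∷ []) (B ∷ ⁅ u ⁆ ∷ []) same-cover ⟩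
      blockSum w (B ∷ ⁅ u ⁆ ∷ [])        ≡⟨ cong₂ _+_ (sym (Wgt≡subsetSum w B)) (trans blockSum-[ ⁅ u ⁆ ] (sym (Wgt≡subsetSum w ⁅ u ⁆))) ⟩
      W B + W ⁅ u ⁆                      ≡⟨ cong (W B +_) (W-⁅⁆ u) ⟩
      W B + w u                          ∎
      where
        open ≡-Reasoning
        same-cover : ∀ x → multiplicity x (B ∪ ⁅ u ⁆ ∷ []) ≡ multiplicity x (B ∷ ⁅ u ⁆ ∷ [])
        same-cover x = trans (ℕ.+-identityʳ _) (trans (indicator-∪-⁅⁆ u∉B x) (cong (indicator B x ℕ.+_) (sym (ℕ.+-identityʳ _))))

    W-empty : ∀ {B} → Empty B → W B ≡ 0#
    W-empty ∄x∈B = trans (cong W (Empty-unique ∄x∈B)) W-⊥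

    overflow⇒nonempty : ∀ {B} u → ¬ (W B + w u ≤ cap) → Nonempty B
    overflow⇒nonempty {B} u overflow with nonempty? B
    ... | yes ∃x∈B = ∃x∈B
    ... | no ∄x∈B  = ⊥-elim (overflow (subst (_≤ cap) (trans (sym (identityˡ (w u))) (cong (_+ w u) (sym (W-empty ∄x∈B)))) (w≤c u)))

    small+small≤cap : ∀ {a b} → InS a → InS b → w a + w b ≤ cap
    small+small≤cap a≤½ b≤½ = subst (_ ≤_) (half+half cap) (+-mono-≤ a≤½ b≤½)

    cap<large+large : ∀ {a b} → InL a → InL b → cap < w a + w b
    cap<large+large ½<a ½<b = subst (_< _) (half+half cap) (+-mono-<-< ½<a ½<b)

    large? : ∀ u → Dec (InL u)
    large? u with compare (half cap) (w u)
    ... | tri< ½<u _ _  = yes ½<u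
    ... | tri≈ ¬½<u _ _ = no ¬½<u
    ... | tri> ¬½<u _ _ = no ¬½<u

    ¬large⇒small : ∀ {u} → ¬ InL u → InS u
    ¬large⇒small {u} ¬½<u with compare (w u) (half cap)
    ... | tri< u<½ _ _  = inj₁ u<½
    ... | tri≈ _ u≡½ _  = inj₂ u≡½
    ... | tri> _ _ ½<u = ⊥-elim (¬½<u ½<u)

    Fits : Subset n → Set
    Fits B = W B ≤ cap

    ⊥-fits : Fits ⊥
    ⊥-fits = subst (_≤ cap) (sym W-⊥) cap≥0

    ⁅⁆-fits : ∀ u → Fits ⁅ u ⁆
    ⁅⁆-fits u = subst (_≤ cap) (sym (W-⁅⁆ u)) (w≤c u)

    blockSum≥0 : ∀ L → 0# ≤ blockSum w L
    blockSum≥0 L = blockSum-mono w w≥0 [] L (λ _ → z≤n)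

    fits⇒one-large : ∀ {B} → Fits B → ∀ {x y} → x ∈ B → y ∈ B → InL x → InL y → x ≡ y
    fits⇒one-large {B} B-fits {x} {y} x∈B y∈B x-large y-large with x ≟ y
    ... | yes x≡y = x≡y
    ... | no x≢y  = ⊥-elim (<-irrefl (begin-strict
      cap                               <⟨ cap<large+large x-large y-large ⟩
      w x + w y                         ≡⟨ cong₂ _+_ (subsetSum-⁅⁆ w x) (trans (identityʳ _) (subsetSum-⁅⁆ w y)) ⟨
      blockSum w (⁅ x ⁆ ∷ ⁅ y ⁆ ∷ [])   ≤⟨ blockSum-mono w w≥0 (⁅ x ⁆ ∷ ⁅ y ⁆ ∷ []) (B ∷ []) both-in-B ⟩
      blockSum w (B ∷ [])               ≡⟨ W≡blockSum B ⟨
      W B                               ≤⟨ B-fits ⟩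
      cap                               ∎))
      where
        open <-Reasoning
        both-in-B : ∀ z → multiplicity z (⁅ x ⁆ ∷ ⁅ y ⁆ ∷ []) ℕ.≤ multiplicity z (B ∷ [])
        both-in-B z = subst₂ ℕ._≤_ (cong (indicator ⁅ x ⁆ z ℕ.+_) (sym (ℕ.+-identityʳ _))) (sym (ℕ.+-identityʳ _))
                        (indicator-⁅⁆+⁅⁆≤ x≢y x∈B y∈B z)

    blockSum≤length·cap : ∀ Q → All Fits Q → blockSum w Q ≤ length Q · cap
    blockSum≤length·cap []      []           = ≤-refl
    blockSum≤length·cap (B ∷ Q) (fits ∷ Q-fit) =
      +-mono-≤ (subst (_≤ cap) (Wgt≡subsetSum w B) fits) (blockSum≤length·cap Q Q-fit)

  module Invariants where
    open RealNumbers ℝ using (Carrier; 0#; _+_; _<_; _≤_)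
    open OrderedFieldProperties ℝ
    open SubsetSums +-orderedCommutativeMonoid
    open OrderedCommutativeMonoid +-orderedCommutativeMonoid using (assoc)
    open Partitioning
    open Weights

    choice⇒small : ∀ {s u} → Choice s u → Nonempty (B₁ s) → InS u
    choice⇒small (_ , inj₁ (_ , u-small))      _     = u-small
    choice⇒small (_ , inj₂ (inj₁ (∄x∈B₁ , _))) ∃x∈B₁ = ⊥-elim (∄x∈B₁ ∃x∈B₁)
    choice⇒small (_ , inj₂ (inj₂ (∄x∈B₁ , _))) ∃x∈B₁ = ⊥-elim (∄x∈B₁ ∃x∈B₁)

    record WellFormed (s : State) : Set where
      field
        P₁-nonempty : All Nonempty (P₁ s)
        P₂-nonempty : All Nonempty (P₂ s)
        P₁-fit      : All Fits (P₁ s)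
        P₂-fit      : All Fits (P₂ s)
        B₁-fits     : Fits (B₁ s)
        B₂-fits     : Fits (B₂ s)
    open WellFormed public

    wellFormed-initial : WellFormed initial
    wellFormed-initial = record
      { P₁-nonempty = [] ; P₂-nonempty = [] ; P₁-fit = [] ; P₂-fit = [] ; B₁-fits = ⊥-fits ; B₂-fits = ⊥-fits }

    wellFormed-step : ∀ {s s′} → Partition s → WellFormed s → Step s s′ → WellFormed s′
    wellFormed-step part wf (fit₁ u _ (u∈V , _) fits) = record
      { P₁-nonempty = P₁-nonempty wf
      ; P₂-nonempty = P₂-nonempty wf
      ; P₁-fit      = P₁-fit wf
      ; P₂-fit      = P₂-fit wf
      ; B₁-fits     = subst (_≤ cap) (sym (W-∪-⁅⁆ (∈V⇒∉B₁ part u∈V))) fits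
      ; B₂-fits     = B₂-fits wf
      }
    wellFormed-step part wf (fit₂ u _ (u∈V , _) _ fits) = record
      { P₁-nonempty = ++⁺ (P₁-nonempty wf) (All-⟦⟧ id)
      ; P₂-nonempty = P₂-nonempty wf
      ; P₁-fit      = ++⁺ (P₁-fit wf) (All-⟦⟧ λ _ → B₁-fits wf)
      ; P₂-fit      = P₂-fit wf
      ; B₁-fits     = ⊥-fits
      ; B₂-fits     = subst (_≤ cap) (sym (W-∪-⁅⁆ (∈V⇒∉B₂ part u∈V))) fits
      }
    wellFormed-step part wf (new₂ u _ _ _ _) = record
      { P₁-nonempty = ++⁺ (P₁-nonempty wf) (All-⟦⟧ id)
      ; P₂-nonempty = ++⁺ (P₂-nonempty wf) (All-⟦⟧ id)
      ; P₁-fit      = ++⁺ (P₁-fit wf) (All-⟦⟧ λ _ → B₁-fits wf)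
      ; P₂-fit      = ++⁺ (P₂-fit wf) (All-⟦⟧ λ _ → B₂-fits wf)
      ; B₁-fits     = ⊥-fits
      ; B₂-fits     = ⁅⁆-fits u
      }

    W₁₂ : State → Carrier
    W₁₂ s = blockSum w (B₂ s ∷ P₁ s ++ P₂ s)

    -- Every closed first bin, together with the item that closed it, weighs more than c,
    -- and that item stays in P₂ ∪ B₂.
    record Overfull (s : State) : Set where
      constructor overfull
      field P₁-overflows : length (P₁ s) ≡ 0 ⊎ length (P₁ s) · cap < W₁₂ s
    open Overfull public

    overfull⇒≤W₁₂ : ∀ {s} → Overfull s → length (P₁ s) · cap ≤ W₁₂ s
    overfull⇒≤W₁₂ {s} (overfull (inj₁ p₁≡0)) rewrite p₁≡0 = blockSum≥0 (B₂ s ∷ P₁ s ++ P₂ s)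
    overfull⇒≤W₁₂     (overfull (inj₂ <W₁₂)) = inj₁ <W₁₂

    overfull-close : ∀ {s s′} u → Overfull s → length (P₁ s′) ≡ suc (length (P₁ s)) →
      (∀ x → multiplicity x (B₂ s′ ∷ P₁ s′ ++ P₂ s′) ≡ multiplicity x (B₁ s ∷ ⁅ u ⁆ ∷ B₂ s ∷ P₁ s ++ P₂ s)) →
      cap < W (B₁ s) + w u → Overfull s′
    overfull-close {s} {s′} u over p₁′≡1+p₁ same-cover overflow = overfull (inj₂ (begin-strict
      length (P₁ s′) · cap                       ≡⟨ cong (_· cap) p₁′≡1+p₁ ⟩
      cap + length (P₁ s) · cap                  <⟨ +-mono-<-≤ overflow (overfull⇒≤W₁₂ over) ⟩
      (W (B₁ s) + w u) + W₁₂ s                   ≡⟨ assoc (W (B₁ s)) (w u) (W₁₂ s) ⟩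
      W (B₁ s) + (w u + W₁₂ s)                   ≡⟨ cong₂ (λ x y → x + (y + W₁₂ s)) (Wgt≡subsetSum w (B₁ s)) (sym (W-⁅⁆ u)) ⟩
      subsetSum w (B₁ s) + (W ⁅ u ⁆ + W₁₂ s)     ≡⟨ cong (λ y → subsetSum w (B₁ s) + (y + W₁₂ s)) (Wgt≡subsetSum w ⁅ u ⁆) ⟩
      blockSum w (B₁ s ∷ ⁅ u ⁆ ∷ B₂ s ∷ P₁ s ++ P₂ s)
        ≡⟨ blockSum-cong w w≥0 (B₂ s′ ∷ P₁ s′ ++ P₂ s′) (B₁ s ∷ ⁅ u ⁆ ∷ B₂ s ∷ P₁ s ++ P₂ s) same-cover ⟨
      W₁₂ s′ ∎))
      where open <-Reasoning

    overfull-step : ∀ {s s′} → Partition s → Overfull s → Step s s′ → Overfull s′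
    overfull-step part over (fit₁ _ _ _ _) = overfull (P₁-overflows over)
    overfull-step part over (fit₂ {P₁} {P₂} {B₁} {B₂} u _ (u∈V , _) overflow₁ _) =
      overfull-close u over (length-++-⟦⟧ P₁ (overflow⇒nonempty u overflow₁))
        (cover-after-fit₂ {P₁} {P₂} {B₁} {B₂} (∈V⇒∉B₂ part u∈V)) (≰⇒> overflow₁)
    overfull-step part over (new₂ {P₁} {P₂} {B₁} {B₂} u _ _ overflow₁ _) =
      overfull-close u over (length-++-⟦⟧ P₁ (overflow⇒nonempty u overflow₁))
        (cover-after-new₂ {P₁} {P₂} {B₁} {B₂} u) (≰⇒> overflow₁)

    ∣P₁∣<∣Q∣ : ∀ {s} → Partition s → Overfull s → ∀ {Q} → bp Q → length (P₁ s) ℕ.< length Q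
    ∣P₁∣<∣Q∣ {s} part (overfull over) {Q} (covering , _ , _ , Q-fit) with suc (length (P₁ s)) ℕ.≤? length Q
    ... | yes p₁<q = p₁<q
    ... | no p₁≮q with over
    ...   | inj₁ p₁≡0 = ⊥-elim (p₁≮q (subst (λ p → suc p ℕ.≤ length Q) (sym p₁≡0) (Q-nonempty (covering x₀))))
      where
        Q-nonempty : Any (x₀ ∈_) Q → 1 ℕ.≤ length Q
        Q-nonempty (here _)  = s≤s z≤n
        Q-nonempty (there _) = s≤s z≤n
    ...   | inj₂ p₁·cap<W₁₂ = ⊥-elim (<-irrefl (begin-strict
      length (P₁ s) · cap  <⟨ p₁·cap<W₁₂ ⟩
      W₁₂ s                ≤⟨ blockSum-mono w w≥0 (B₂ s ∷ P₁ s ++ P₂ s) (⊤ ∷ []) covered-once ⟩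
      blockSum w (⊤ ∷ [])  ≤⟨ blockSum-mono w w≥0 (⊤ ∷ []) Q (λ x → Any⇒multiplicity-[⊤]≤ (covering x)) ⟩
      blockSum w Q         ≤⟨ blockSum≤length·cap Q Q-fit ⟩
      length Q · cap       ≤⟨ ·-monoˡ-≤ cap cap≥0 (ℕ.≤-pred (ℕ.≰⇒> p₁≮q)) ⟩
      length (P₁ s) · cap  ∎))
      where
        open <-Reasoning
        covered-once : ∀ x → multiplicity x (B₂ s ∷ P₁ s ++ P₂ s) ℕ.≤ multiplicity x (⊤ ∷ [])
        covered-once x = ℕ.≤-trans (multiplicity-B₂P₁P₂≤tally s x)
          (ℕ.≤-reflexive (trans (covers-once part x) (sym (multiplicity-[⊤] x))))

    -- Every closed second bin is paid for by two closed first bins; the stage of the open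
    -- second bin records how much of the next payment has been made.
    data Stage (B : Subset n) : ℕ → Set where
      empty  : Empty B → Stage B 0
      single : ∀ {v} → B ≡ ⁅ v ⁆ → InS v → Stage B 1
      mature : Stage B 2

    record Balanced (s : State) : Set where
      constructor balanced
      field
        {stage}  : ℕ
        B₂-stage : Stage (B₂ s) stage
        P₂-paid  : 2 ℕ.* length (P₂ s) ℕ.+ stage ℕ.≤ length (P₁ s)
    open Balanced public

    balanced-initial : Balanced initial
    balanced-initial = balanced (empty λ (x , x∈⊥) → ∉⊥ x∈⊥) z≤n

    balanced-close : ∀ {s s′} (bal : Balanced s) → length (P₂ s′) ≡ length (P₂ s) →
      length (P₁ s′) ≡ suc (length (P₁ s)) → ∀ {k′} → Stage (B₂ s′) k′ → k′ ℕ.≤ suc (stage bal) → Balanced s′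
    balanced-close {s} {s′} bal p₂′≡p₂ p₁′≡1+p₁ {k′} stage′ k′≤1+k = balanced stage′ (begin
      2 ℕ.* length (P₂ s′) ℕ.+ k′              ≡⟨ cong (λ p → 2 ℕ.* p ℕ.+ k′) p₂′≡p₂ ⟩
      2 ℕ.* length (P₂ s) ℕ.+ k′               ≤⟨ ℕ.+-monoʳ-≤ (2 ℕ.* length (P₂ s)) k′≤1+k ⟩
      2 ℕ.* length (P₂ s) ℕ.+ suc (stage bal)  ≡⟨ ℕ.+-suc _ (stage bal) ⟩
      suc (2 ℕ.* length (P₂ s) ℕ.+ stage bal)  ≤⟨ s≤s (P₂-paid bal) ⟩
      suc (length (P₁ s))                      ≡⟨ p₁′≡1+p₁ ⟨
      length (P₁ s′)                           ∎)
      where open ℕ.≤-Reasoning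

    balanced-step : ∀ {s s′} → Balanced s → Step s s′ → Balanced s′
    balanced-step bal (fit₁ _ _ _ _) = balanced (B₂-stage bal) (P₂-paid bal)
    balanced-step {s} bal (fit₂ {P₁} {B₂ = B₂} u _ choice overflow₁ _) with B₂-stage bal
    ... | empty ∄x∈B₂ = balanced-close bal refl p₁′≡1+p₁ (single B₂∪u≡⁅u⁆ (choice⇒small {s} choice ∃x∈B₁)) (s≤s z≤n)
      where
        ∃x∈B₁ = overflow⇒nonempty u overflow₁
        p₁′≡1+p₁ = length-++-⟦⟧ P₁ ∃x∈B₁
        B₂∪u≡⁅u⁆ : B₂ ∪ ⁅ u ⁆ ≡ ⁅ u ⁆
        B₂∪u≡⁅u⁆ = trans (cong (_∪ ⁅ u ⁆) (Empty-unique ∄x∈B₂)) (∪-identityˡ ⁅ u ⁆)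
    ... | single _ _  = balanced-close bal refl (length-++-⟦⟧ P₁ (overflow⇒nonempty u overflow₁)) mature ℕ.≤-refl
    ... | mature      = balanced-close bal refl (length-++-⟦⟧ P₁ (overflow⇒nonempty u overflow₁)) mature (ℕ.n≤1+n 2)
    balanced-step {s} bal (new₂ {P₁} {P₂} {B₂ = B₂} u _ choice overflow₁ overflow₂) with B₂-stage bal
    ... | empty ∄x∈B₂ = ⊥-elim (∄x∈B₂ (overflow⇒nonempty u overflow₂))
    ... | single {v} B₂≡⁅v⁆ v-small =
      ⊥-elim (overflow₂ (subst (λ B → W B + w u ≤ cap) (sym B₂≡⁅v⁆)
                          (subst (λ x → x + w u ≤ cap) (sym (W-⁅⁆ v)) (small+small≤cap v-small u-small))))
      where u-small = choice⇒small {s} choice (overflow⇒nonempty u overflow₁)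
    ... | mature = balanced (single refl (choice⇒small {s} choice (overflow⇒nonempty u overflow₁)))
      (subst₂ (λ p₂ p₁ → 2 ℕ.* p₂ ℕ.+ 1 ℕ.≤ p₁)
         (sym (length-++-⟦⟧ P₂ (overflow⇒nonempty u overflow₂))) (sym (length-++-⟦⟧ P₁ (overflow⇒nonempty u overflow₁)))
         (ℕ.≤-trans (ℕ.≤-reflexive (twice-suc (length P₂))) (s≤s (P₂-paid bal))))
      where
        twice-suc : ∀ p → 2 ℕ.* suc p ℕ.+ 1 ≡ suc (2 ℕ.* p ℕ.+ 2)
        twice-suc = solve-∀

    length-⟦⟧≤stage : ∀ {B k} → Stage B k → length ⟦ B ⟧ ℕ.≤ k
    length-⟦⟧≤stage {B} (empty ∄x∈B) = ℕ.≤-reflexive (length-⟦⟧-empty ∄x∈B)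
    length-⟦⟧≤stage {B} (single _ _) = length-⟦⟧≤1 B
    length-⟦⟧≤stage {B} mature       = ℕ.m≤n⇒m≤1+n (length-⟦⟧≤1 B)

    balanced⇒2∣P₂B₂∣≤∣P₁B₂∣ : ∀ {s} → Balanced s →
      2 ℕ.* (length (P₂ s) ℕ.+ length ⟦ B₂ s ⟧) ℕ.≤ length (P₁ s) ℕ.+ length ⟦ B₂ s ⟧
    balanced⇒2∣P₂B₂∣≤∣P₁B₂∣ {s} bal = begin
      2 ℕ.* (p₂ ℕ.+ b₂)          ≡⟨ twice-sum p₂ b₂ ⟩
      2 ℕ.* p₂ ℕ.+ b₂ ℕ.+ b₂     ≤⟨ ℕ.+-monoˡ-≤ b₂ (ℕ.+-monoʳ-≤ (2 ℕ.* p₂) (length-⟦⟧≤stage (B₂-stage bal))) ⟩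
      2 ℕ.* p₂ ℕ.+ stage bal ℕ.+ b₂ ≤⟨ ℕ.+-monoˡ-≤ b₂ (P₂-paid bal) ⟩
      length (P₁ s) ℕ.+ b₂       ∎
      where
        open ℕ.≤-Reasoning
        p₂ = length (P₂ s)
        b₂ = length ⟦ B₂ s ⟧
        twice-sum : ∀ p b → 2 ℕ.* (p ℕ.+ b) ≡ 2 ℕ.* p ℕ.+ b ℕ.+ b
        twice-sum = solve-∀

    HasLarge : Subset n → Set
    HasLarge B = ∃ λ v → v ∈ B × InL v

    -- While large items remain, an empty first bin is always opened with a large item.
    LargeFirst : State → Set
    LargeFirst s = HasLarge (V s) → All HasLarge (P₁ s) × (Empty (B₁ s) ⊎ HasLarge (B₁ s))

    largeFirst-initial : LargeFirst initial
    largeFirst-initial _ = [] , inj₁ λ (x , x∈⊥) → ∉⊥ x∈⊥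

    nonempty⇒large : ∀ {B} → Empty B ⊎ HasLarge B → Nonempty B → HasLarge B
    nonempty⇒large (inj₁ ∄x∈B) ∃x∈B = ⊥-elim (∄x∈B ∃x∈B)
    nonempty⇒large (inj₂ large) _    = large

    largeFirst-close : ∀ {P₁ B₁} → All HasLarge P₁ × (Empty B₁ ⊎ HasLarge B₁) → Nonempty B₁ →
      All HasLarge (P₁ ++ ⟦ B₁ ⟧) × (Empty (⊥ {n}) ⊎ HasLarge ⊥)
    largeFirst-close (P₁-large , B₁-large) ∃x∈B₁ =
      ++⁺ P₁-large (All-⟦⟧ λ _ → nonempty⇒large B₁-large ∃x∈B₁) , inj₁ λ (x , x∈⊥) → ∉⊥ x∈⊥

    largeFirst-step : ∀ {s s′} → LargeFirst s → Step s s′ → LargeFirst s′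
    largeFirst-step first (fit₁ {B₁ = B₁} {V = V} u _ (_ , rule) _) (v , v∈V-u , v-large)
      with first (v , p─q⊆p V ⁅ u ⁆ v∈V-u , v-large)
    ... | P₁-large , inj₂ (x , x∈B₁ , x-large) = P₁-large , inj₂ (x , x∈p∪q⁺ (inj₁ x∈B₁) , x-large)
    ... | P₁-large , inj₁ ∄x∈B₁ = P₁-large , inj₂ (u , x∈p∪q⁺ (inj₂ (x∈⁅x⁆ u)) , opened-large rule)
      where
        opened-large : _ → InL u
        opened-large (inj₁ (∃x∈B₁ , _))                 = ⊥-elim (∄x∈B₁ ∃x∈B₁)
        opened-large (inj₂ (inj₁ (_ , _ , u-large)))   = u-large
        opened-large (inj₂ (inj₂ (_ , ∄large , _)))    = ⊥-elim (∄large (v , p─q⊆p V ⁅ u ⁆ v∈V-u , v-large))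
    largeFirst-step first (fit₂ {V = V} u _ _ overflow₁ _) (v , v∈V-u , v-large) =
      largeFirst-close (first (v , p─q⊆p V ⁅ u ⁆ v∈V-u , v-large)) (overflow⇒nonempty u overflow₁)
    largeFirst-step first (new₂ {V = V} u _ _ overflow₁ _) (v , v∈V-u , v-large) =
      largeFirst-close (first (v , p─q⊆p V ⁅ u ⁆ v∈V-u , v-large)) (overflow⇒nonempty u overflow₁)

    ∣P₁B₁V∣≤∣Q∣ : ∀ {s} → Partition s → LargeFirst s → Terminated s → ∀ {Q} → bp Q →
      1 ℕ.≤ length (singletons (V s)) → length (P₁ s ++ ⟦ B₁ s ⟧ ++ singletons (V s)) ℕ.≤ length Q
    ∣P₁B₁V∣≤∣Q∣ {s} part first done {Q} (covering , _ , _ , Q-fit) 1≤r =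
      hitting-disjoint≤separating-cover large? (P₁ s ++ ⟦ B₁ s ⟧ ++ singletons (V s)) Q
        hitting disjoint covering (All.map (fits⇒one-large) Q-fit)
      where
        V-large : ∀ {v} → v ∈ V s → InL v
        V-large {v} v∈V with large? v
        ... | yes v-large = v-large
        ... | no ¬large   = ⊥-elim (done (v , v∈V , ¬large⇒small ¬large))
        singletons-large : All HasLarge (singletons (V s))
        singletons-large = map⁺ (All.map (λ {v} v∈V → v , x∈⁅x⁆ v , V-large v∈V) (all-filter (_∈? V s) (allFin n)))
        hitting : All HasLarge (P₁ s ++ ⟦ B₁ s ⟧ ++ singletons (V s))
        hitting with member-of-singletons (V s) 1≤r
        ... | v , v∈V with first (v , v∈V , V-large v∈V)
        ...   | P₁-large , B₁-large = ++⁺ P₁-large (++⁺ (All-⟦⟧ (nonempty⇒large B₁-large)) singletons-large)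
        disjoint : ∀ x → multiplicity x (P₁ s ++ ⟦ B₁ s ⟧ ++ singletons (V s)) ℕ.≤ 1
        disjoint x = ℕ.≤-trans (multiplicity-P₁B₁V≤tally s x) (ℕ.≤-reflexive (covers-once part x))

    bp-output : ∀ {s} → Partition s → WellFormed s → bp (output s)
    bp-output {s} part wf =
        (λ x → multiplicity-≥1⇒Any (output s) (ℕ.≤-reflexive (sym (once x))))
      , multiplicity≤1⇒disjoint (output s) (λ x → ℕ.≤-reflexive (once x))
      , ++⁺ (P₁-nonempty wf) (++⁺ (All-⟦⟧ id) (++⁺ (P₂-nonempty wf) (++⁺ (All-⟦⟧ id)
          (All-singletons (V s) λ v → v , x∈⁅x⁆ v))))
      , ++⁺ (P₁-fit wf) (++⁺ (All-⟦⟧ λ _ → B₁-fits wf) (++⁺ (P₂-fit wf) (++⁺ (All-⟦⟧ λ _ → B₂-fits wf)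
          (All-singletons (V s) ⁅⁆-fits))))
      where
        once : ∀ x → multiplicity x (output s) ≡ 1
        once x = trans (multiplicity-output s x) (covers-once part x)

    reachable⇒wellFormed : ∀ {s} → Reachable s → WellFormed s
    reachable⇒wellFormed = reachable-invariant WellFormed wellFormed-initial
      (λ r → wellFormed-step (reachable⇒partition r))

    reachable⇒overfull : ∀ {s} → Reachable s → Overfull s
    reachable⇒overfull = reachable-invariant Overfull (overfull (inj₁ refl))
      (λ r → overfull-step (reachable⇒partition r))

    reachable⇒balanced : ∀ {s} → Reachable s → Balanced s
    reachable⇒balanced = reachable-invariant Balanced balanced-initial (λ _ → balanced-step)

    reachable⇒largeFirst : ∀ {s} → Reachable s → LargeFirst s
    reachable⇒largeFirst = reachable-invariant LargeFirst largeFirst-initial (λ _ → largeFirst-step)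

  length-output : ∀ s → length (output s) ≡
    length (P₁ s) ℕ.+ (length ⟦ B₁ s ⟧ ℕ.+ (length (P₂ s) ℕ.+ (length ⟦ B₂ s ⟧ ℕ.+ length (singletons (V s)))))
  length-output ⟨ P₁ , P₂ , B₁ , B₂ , V ⟩ =
    trans (length-++ P₁) (cong (length P₁ ℕ.+_) (trans (length-++ ⟦ B₁ ⟧) (cong (length ⟦ B₁ ⟧ ℕ.+_)
      (trans (length-++ P₂) (cong (length P₂ ℕ.+_) (length-++ ⟦ B₂ ⟧))))))

  length-P₁B₁V : ∀ s → length (P₁ s ++ ⟦ B₁ s ⟧ ++ singletons (V s)) ≡ length (P₁ s) ℕ.+ (length ⟦ B₁ s ⟧ ℕ.+ length (singletons (V s)))
  length-P₁B₁V ⟨ P₁ , P₂ , B₁ , B₂ , V ⟩ = trans (length-++ P₁) (cong (length P₁ ℕ.+_) (length-++ ⟦ B₁ ⟧))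

  output-size-bound : ∀ {s} → Reachable s → Terminated s → ∀ Q → bp Q → 2 ℕ.* length (output s) ℕ.≤ 3 ℕ.* length Q
  output-size-bound {s} reachable terminated Q bpQ =
    subst (λ ℓ → 2 ℕ.* ℓ ℕ.≤ 3 ℕ.* length Q) (sym (length-output s))
      (three-halves-bound p₁ b₁ p₂ b₂ r (length Q)
        (∣P₁∣<∣Q∣ partition (reachable⇒overfull reachable) bpQ)
        (balanced⇒2∣P₂B₂∣≤∣P₁B₂∣ (reachable⇒balanced reachable))
        (length-⟦⟧≤1 (B₁ s)) (length-⟦⟧≤1 (B₂ s))
        (λ 1≤r → subst (ℕ._≤ length Q) (length-P₁B₁V s)
                   (∣P₁B₁V∣≤∣Q∣ partition (reachable⇒largeFirst reachable) terminated bpQ 1≤r)))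
    where
      open Invariants
      partition = Partitioning.reachable⇒partition reachable
      p₁ = length (P₁ s)
      b₁ = length ⟦ B₁ s ⟧
      p₂ = length (P₂ s)
      b₂ = length ⟦ B₂ s ⟧
      r  = length (singletons (V s))

open import Data.Nat using (_<_; _*_; _≤_)

mainTheorem7 : (ℝ : RealNumbers) (n : ℕ) → 0 < n → (c : ℕ) → (w : Fin n → RealNumbers.Carrier ℝ) →
    (∀ u → RealNumbers._<_ ℝ (RealNumbers.0# ℝ) (w u)) →
    (∀ u → RealNumbers._≤_ ℝ (w u) (RealNumbers.fromℕ ℝ c)) →
    (s : BinPacking.State ℝ c w) → BinPacking.Reachable ℝ c w s → BinPacking.Terminated ℝ c w s →
    BinPacking.bp ℝ c w (BinPacking.output ℝ c w s)
    × ((Q : List (Subset n)) → BinPacking.bp ℝ c w Q →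
    2 * length (BinPacking.output ℝ c w s) ≤ 3 * length Q)
mainTheorem7 ℝ n 0<n c w w-pos w≤c s reachable terminated =
    bp-output (Partitioning.reachable⇒partition reachable) (reachable⇒wellFormed reachable)
  , output-size-bound reachable terminated
  where
    open Analysis ℝ c w w-pos w≤c (fromℕ< 0<n)
    open Invariants using (bp-output; reachable⇒wellFormed)
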